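{- Let $n\ge1$ and let $\nu$ be a partition of $n-1$. Then $$n\,f_\nu=\sum_{\substack{\mu\vdash n\\ \nu\subseteq\mu}} f_\mu\,\bigl(1-2c(\mu/\nu)\bigr).$$
   Context: $f_\lambda$ is the number of standard Young tableaux of shape $\lambda$ (with $f_\emptyset=1$). Partitions are identified with their Young diagrams; $\nu\subseteq\mu$ with $|\mu|=|\nu|+1$ means $\mu$ is obtained from $\nu$ by adding one box, and $c(\mu/\nu)=j-i$ is the content of that added box, where $(i,j)$ is its (row, column) position. -}

module Defs where

open import Data.Bool using (Bool; true; false; _∧_; _∨_; not; if_then_else_)
open import Data.Nat using (ℕ; zero; suc; _+_; _<ᵇ_; _≡ᵇ_; _≥_; NonZero)
open import Data.Nat.Properties using (_≥?_)
open import Data.Product using (_×_; _,_)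
open import Data.List using (List; []; _∷_; [_]; _++_; map; concatMap; upTo; length; zip; filter; filterᵇ; foldr)
open import Data.List.Relation.Unary.All using (All; all?)
open import Data.List.Relation.Unary.Linked using (Linked; linked?)
open import Relation.Nullary using (Dec)
open import Relation.Nullary.Decidable using (_×-dec_)
open import Data.Integer as ℤ using (ℤ)
open import Data.Nat.ListAction using (sum)

Positive : ℕ → Set
Positive n = NonZero n

positive? : (n : ℕ) → Dec (Positive n)
positive? zero = Relation.Nullary.no (λ ())
positive? (suc n) = Relation.Nullary.yes _

IsPartition : List ℕ → Set
IsPartition λ′ = Linked _≥_ λ′ × All Positive λ′

isPartition? : (λ′ : List ℕ) → Dec (IsPartition λ′)
isPartition? λ′ = linked? _≥?_ λ′ ×-dec all? positive? λ′

size : List ℕ → ℕ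
size = sum

-- Young diagram cells (0-indexed (row , column)), listed in row-reading order.

cellsFrom : ℕ → List ℕ → List (ℕ × ℕ)
cellsFrom i [] = []
cellsFrom i (r ∷ rs) = map (λ j → (i , j)) (upTo r) ++ cellsFrom (suc i) rs

cells : List ℕ → List (ℕ × ℕ)
cells = cellsFrom 0

-- A filling of λ with n = |λ| cells is a list T of length n, T's p-th entry
-- being the label of the p-th cell (row-reading order), labels in {0,…,n-1}.
-- It is standard iff the labels are pairwise distinct (so it is a bijection
-- onto {0,…,n-1}) and strictly increase along rows and down columns.

elemᵇ : ℕ → List ℕ → Bool
elemᵇ x [] = false
elemᵇ x (y ∷ ys) = (x ≡ᵇ y) ∨ elemᵇ x ys

distinctᵇ : List ℕ → Bool
distinctᵇ [] = true
distinctᵇ (x ∷ xs) = not (elemᵇ x xs) ∧ distinctᵇ xs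

adjacentᵇ : ℕ × ℕ → ℕ × ℕ → Bool
adjacentᵇ (i , j) (i′ , j′) =
  ((i′ ≡ᵇ i) ∧ (j′ ≡ᵇ suc j)) ∨ ((i′ ≡ᵇ suc i) ∧ (j′ ≡ᵇ j))

allᵇ : {A : Set} → (A → Bool) → List A → Bool
allᵇ p = foldr (λ x b → p x ∧ b) true

increasingᵇ : List ((ℕ × ℕ) × ℕ) → Bool
increasingᵇ F =
  allᵇ (λ { (c , a) → allᵇ (λ { (d , b) → not (adjacentᵇ c d) ∨ (a <ᵇ b) }) F }) F

isSYTᵇ : List ℕ → List ℕ → Bool
isSYTᵇ λ′ T = distinctᵇ T ∧ increasingᵇ (zip (cells λ′) T)

allLists : ℕ → ℕ → List (List ℕ)
allLists zero m = [ [] ]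
allLists (suc k) m = concatMap (λ x → map (x ∷_) (allLists k m)) (upTo m)

f : List ℕ → ℕ
f λ′ = length (filterᵇ (isSYTᵇ λ′) (allLists (size λ′) (size λ′)))

-- Adding one box to row i (0-indexed) of ν; i = length ν means a new row.

addBox : List ℕ → ℕ → List ℕ
addBox [] zero = [ 1 ]
addBox [] (suc i) = []
addBox (r ∷ rs) zero = suc r ∷ rs
addBox (r ∷ rs) (suc i) = r ∷ addBox rs i

-- i-th part of ν (0 if i ≥ length ν)
part : List ℕ → ℕ → ℕ
part [] i = 0
part (r ∷ rs) zero = r
part (r ∷ rs) (suc i) = part rs i

-- The partitions μ ⊢ |ν|+1 with ν ⊆ μ are exactly addBox ν i for the rows
-- i ∈ {0,…,length ν} such that addBox ν i is a partition (each μ arises from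
-- exactly one such i).
addableRows : List ℕ → List ℕ
addableRows ν = filter (λ i → isPartition? (addBox ν i)) (upTo (suc (length ν)))

-- content c(μ/ν) of the box added in row i: it sits at 1-indexed position
-- (i+1 , ν_i + 1), so its content is (ν_i + 1) - (i + 1) = ν_i - i.
contentAdded : List ℕ → ℕ → ℤ
contentAdded ν i = ℤ.+ (part ν i) ℤ.- ℤ.+ i

rhsSum : List ℕ → ℤ
rhsSum ν = foldr ℤ._+_ (ℤ.+ 0)
  (map (λ i → ℤ.+ (f (addBox ν i)) ℤ.* (ℤ.+ 1 ℤ.- ℤ.+ 2 ℤ.* contentAdded ν i))
       (addableRows ν))

module Submission where

-- Write f for the number of standard Young tableaux, and for a weight w let
-- upSum w ν = Σ_a [row a addable] · w(a, ν_a) · f (ν + box in row a).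
-- The right-hand side is upSum 1 ν - 2 · upSum c ν, where c(a, ν_a) = ν_a - a is the
-- content of the added box, so the theorem says upSum 1 ν = (|ν|+1) f ν and upSum c ν = 0.
--
-- Both follow from one recursion.  The branching rule f μ = Σ_{corners r} f (μ - r)
-- is proved by removing the largest label of a tableau, which sits in a corner.
-- Expanding each f (ν + a) by it and commuting "add at a" with "remove at r ≠ a"
-- (the up-down relation of Young's lattice) gives
--   upSum w ν + R·f ν = A·f ν + Σ_{corners r} upSum w (ν - r),
-- where A, R are the total weights of the addable and of the removable cells.
-- If A - R is a constant e (e = 1 for w = 1, e = 0 for the content), induction on |ν|
-- yields upSum w ν = e (|ν|+1) f ν.

open import Defs

module Lists where

  open import Data.Empty using (⊥; ⊥-elim)
  open import Data.Nat using (ℕ; zero; suc; _+_; _≤_; _<_; z≤n; s≤s)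
  open import Data.Nat.Properties using (suc-injective; +-suc; ≤-antisym; 0≢1+n; 1+n≢0)
  open import Data.Product using (_×_; _,_; ∃; ∃₂)
  open import Data.Sum using (_⊎_; inj₁; inj₂)
  open import Data.List using (List; []; _∷_; _++_; length; zip; concatMap)
  open import Data.List.Properties using (∷-injectiveˡ; ∷-injectiveʳ; length-++)
  open import Data.List.Relation.Unary.All as All using (All; []; _∷_)
  open import Data.List.Relation.Unary.All.Properties using (¬Any⇒All¬)
  open import Data.List.Relation.Unary.Any using (here; there)
  open import Data.List.Relation.Unary.AllPairs using ([]; _∷_)
  open import Data.List.Relation.Unary.Unique.Propositional using (Unique)
  open import Data.List.Membership.Propositional using (_∈_; _∉_; find)
  open import Data.List.Membership.Propositional.Properties using (∈-∃++; ∈-++⁺ˡ; ∈-++⁺ʳ; ∈-++⁻; ∈-concatMap⁻)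
  import Data.List.Relation.Unary.Unique.Propositional.Properties as Unique
  open import Relation.Binary.PropositionalEquality using (_≡_; refl; sym; trans; cong; cong₂; subst)

  unique-⊆⇒length≤ : ∀ {A : Set} {xs ys : List A} → Unique xs → (∀ {x} → x ∈ xs → x ∈ ys) → length xs ≤ length ys
  unique-⊆⇒length≤ {xs = []}     _        _     = z≤n
  unique-⊆⇒length≤ {xs = x ∷ xs} (x∉ ∷ u) xs⊆ys with ∈-∃++ (xs⊆ys (here refl))
  ... | ys₁ , ys₂ , refl = subst (suc (length xs) ≤_) (sym (length-middle ys₁ ys₂))
        (s≤s (unique-⊆⇒length≤ u xs⊆ys₁ys₂))
    where
    length-middle : ∀ (us vs : List _) → length (us ++ x ∷ vs) ≡ suc (length (us ++ vs))
    length-middle us vs = trans (length-++ us) (trans (+-suc (length us) (length vs)) (cong suc (sym (length-++ us))))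
    xs⊆ys₁ys₂ : ∀ {y} → y ∈ xs → y ∈ ys₁ ++ ys₂
    xs⊆ys₁ys₂ y∈ with ∈-++⁻ ys₁ (xs⊆ys (there y∈))
    ... | inj₁ y∈₁         = ∈-++⁺ˡ y∈₁
    ... | inj₂ (here refl) = ⊥-elim (All.lookup x∉ y∈ refl)
    ... | inj₂ (there y∈₂) = ∈-++⁺ʳ ys₁ y∈₂

  unique-same-members⇒same-length : ∀ {A : Set} {xs ys : List A} → Unique xs → Unique ys →
    (∀ {x} → x ∈ xs → x ∈ ys) → (∀ {x} → x ∈ ys → x ∈ xs) → length xs ≡ length ys
  unique-same-members⇒same-length ux uy xs⊆ys ys⊆xs = ≤-antisym (unique-⊆⇒length≤ ux xs⊆ys) (unique-⊆⇒length≤ uy ys⊆xs)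

  concatMap-unique : ∀ {A B : Set} (F : A → List B) {xs} → Unique xs → (∀ x → Unique (F x)) →
    (∀ {x y v} → v ∈ F x → v ∈ F y → x ≡ y) → Unique (concatMap F xs)
  concatMap-unique F {[]}     _        _       _        = []
  concatMap-unique F {x ∷ xs} (x∉ ∷ u) uniqueF disjoint =
    Unique.++⁺ (uniqueF x) (concatMap-unique F u uniqueF disjoint) separate
    where
    separate : ∀ {v} → v ∈ F x × v ∈ concatMap F xs → ⊥
    separate (v∈Fx , v∈rest) with find (∈-concatMap⁻ F v∈rest)
    ... | y , y∈xs , v∈Fy = All.lookup x∉ y∈xs (disjoint v∈Fx v∈Fy)

  -- insertAt p x ys puts x at position p of ys (at the end if p ≥ length ys).
  insertAt : {A : Set} → ℕ → A → List A → List A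
  insertAt zero    x ys       = x ∷ ys
  insertAt (suc p) x []       = x ∷ []
  insertAt (suc p) x (y ∷ ys) = y ∷ insertAt p x ys

  module _ {A : Set} where

    length-insertAt : ∀ p (x : A) ys → length (insertAt p x ys) ≡ suc (length ys)
    length-insertAt zero    x ys       = refl
    length-insertAt (suc p) x []       = refl
    length-insertAt (suc p) x (y ∷ ys) = cong suc (length-insertAt p x ys)

    ∈-insertAt-self : ∀ p (x : A) ys → x ∈ insertAt p x ys
    ∈-insertAt-self zero    x ys       = here refl
    ∈-insertAt-self (suc p) x []       = here refl
    ∈-insertAt-self (suc p) x (y ∷ ys) = there (∈-insertAt-self p x ys)

    ∈-insertAt⁺ : ∀ p (x : A) {y ys} → y ∈ ys → y ∈ insertAt p x ys
    ∈-insertAt⁺ zero    x y∈        = there y∈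
    ∈-insertAt⁺ (suc p) x (here eq) = here eq
    ∈-insertAt⁺ (suc p) x (there y∈) = there (∈-insertAt⁺ p x y∈)

    ∈-insertAt⁻ : ∀ p (x : A) ys {y} → y ∈ insertAt p x ys → y ≡ x ⊎ y ∈ ys
    ∈-insertAt⁻ zero    x ys       (here eq)  = inj₁ eq
    ∈-insertAt⁻ zero    x ys       (there y∈) = inj₂ y∈
    ∈-insertAt⁻ (suc p) x []       (here eq)  = inj₁ eq
    ∈-insertAt⁻ (suc p) x (z ∷ ys) (here eq)  = inj₂ (here eq)
    ∈-insertAt⁻ (suc p) x (z ∷ ys) (there y∈) with ∈-insertAt⁻ p x ys y∈
    ... | inj₁ eq  = inj₁ eq
    ... | inj₂ y∈′ = inj₂ (there y∈′)

    insertAt-injective : ∀ p (x : A) ys zs → insertAt p x ys ≡ insertAt p x zs → ys ≡ zs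
    insertAt-injective zero    x ys       zs       eq = ∷-injectiveʳ eq
    insertAt-injective (suc p) x []       []       eq = refl
    insertAt-injective (suc p) x []       (z ∷ zs) eq =
      ⊥-elim (0≢1+n (trans (cong length (∷-injectiveʳ eq)) (length-insertAt p x zs)))
    insertAt-injective (suc p) x (y ∷ ys) []       eq =
      ⊥-elim (1+n≢0 (trans (sym (length-insertAt p x ys)) (cong length (∷-injectiveʳ eq))))
    insertAt-injective (suc p) x (y ∷ ys) (z ∷ zs) eq =
      cong₂ _∷_ (∷-injectiveˡ eq) (insertAt-injective p x ys zs (∷-injectiveʳ eq))

    insertAt-++ : ∀ (xs : List A) p x ys → insertAt (length xs + p) x (xs ++ ys) ≡ xs ++ insertAt p x ys
    insertAt-++ []       p x ys = refl
    insertAt-++ (z ∷ xs) p x ys = cong (z ∷_) (insertAt-++ xs p x ys)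

    insertAt-split : ∀ p (ys : List A) → p < length ys → ∃₂ λ x zs → ys ≡ insertAt p x zs
    insertAt-split zero    (y ∷ ys) _       = y , ys , refl
    insertAt-split (suc p) (y ∷ ys) (s≤s lt) with insertAt-split p ys lt
    ... | x , zs , refl = x , y ∷ zs , refl

    Unique-insertAt⁺ : ∀ p (x : A) {ys} → Unique ys → x ∉ ys → Unique (insertAt p x ys)
    Unique-insertAt⁺ zero    x {ys}     u        x∉ = ¬Any⇒All¬ ys x∉ ∷ u
    Unique-insertAt⁺ (suc p) x {[]}     u        x∉ = [] ∷ []
    Unique-insertAt⁺ (suc p) x {y ∷ ys} (y∉ ∷ u) x∉ =
      All.tabulate y≢ ∷ Unique-insertAt⁺ p x u (λ x∈ → x∉ (there x∈))
      where
      y≢ : ∀ {z} → z ∈ insertAt p x ys → y ≡ z → ⊥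
      y≢ z∈ y≡z with ∈-insertAt⁻ p x ys z∈
      ... | inj₁ refl = x∉ (here (sym y≡z))
      ... | inj₂ z∈′ = All.lookup y∉ z∈′ y≡z

    Unique-insertAt⁻ : ∀ p (x : A) ys → Unique (insertAt p x ys) → Unique ys × x ∉ ys
    Unique-insertAt⁻ zero    x ys       (x∉ ∷ u) = u , λ x∈ → All.lookup x∉ x∈ refl
    Unique-insertAt⁻ (suc p) x []       u        = [] , λ ()
    Unique-insertAt⁻ (suc p) x (y ∷ ys) (y∉ ∷ u) with Unique-insertAt⁻ p x ys u
    ... | u′ , x∉ = All.tabulate (λ z∈ → All.lookup y∉ (∈-insertAt⁺ p x z∈)) ∷ u′ , x∉′
      where
      x∉′ : x ∉ y ∷ ys
      x∉′ (here x≡y) = All.lookup y∉ (∈-insertAt-self p x ys) (sym x≡y)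
      x∉′ (there x∈) = x∉ x∈

  module _ {A B : Set} where

    zip-insertAt : ∀ p (x : A) (y : B) xs ys → length xs ≡ length ys →
      zip (insertAt p x xs) (insertAt p y ys) ≡ insertAt p (x , y) (zip xs ys)
    zip-insertAt zero    x y xs       ys       _   = refl
    zip-insertAt (suc p) x y []       []       _   = refl
    zip-insertAt (suc p) x y (a ∷ xs) (b ∷ ys) len =
      cong ((a , b) ∷_) (zip-insertAt p x y xs ys (suc-injective len))

    zip-∈₁ : ∀ (xs : List A) (ys : List B) {a b} → (a , b) ∈ zip xs ys → a ∈ xs
    zip-∈₁ (x ∷ xs) (y ∷ ys) (here refl) = here refl
    zip-∈₁ (x ∷ xs) (y ∷ ys) (there ab∈) = there (zip-∈₁ xs ys ab∈)

    zip-∈₂ : ∀ (xs : List A) (ys : List B) {a b} → (a , b) ∈ zip xs ys → b ∈ ys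
    zip-∈₂ (x ∷ xs) (y ∷ ys) (here refl) = here refl
    zip-∈₂ (x ∷ xs) (y ∷ ys) (there ab∈) = there (zip-∈₂ xs ys ab∈)

    zip-partner₂ : ∀ (xs : List A) (ys : List B) {a} → a ∈ xs → length xs ≡ length ys →
      ∃ λ b → (a , b) ∈ zip xs ys
    zip-partner₂ (x ∷ xs) (y ∷ ys) (here refl) _   = y , here refl
    zip-partner₂ (x ∷ xs) (y ∷ ys) (there a∈)  len with zip-partner₂ xs ys a∈ (suc-injective len)
    ... | b , ab∈ = b , there ab∈

    zip-partner₁ : ∀ (xs : List A) (ys : List B) {b} → b ∈ ys → length xs ≡ length ys →
      ∃ λ a → (a , b) ∈ zip xs ys
    zip-partner₁ (x ∷ xs) (y ∷ ys) (here refl) _   = x , here refl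
    zip-partner₁ (x ∷ xs) (y ∷ ys) (there b∈)  len with zip-partner₁ xs ys b∈ (suc-injective len)
    ... | a , ab∈ = a , there ab∈

    zip-partner-unique : ∀ (xs : List A) (ys : List B) {a a′ b} → Unique ys →
      (a , b) ∈ zip xs ys → (a′ , b) ∈ zip xs ys → a ≡ a′
    zip-partner-unique (x ∷ xs) (y ∷ ys) u        (here refl) (here refl) = refl
    zip-partner-unique (x ∷ xs) (y ∷ ys) (y∉ ∷ u) (here refl) (there m)   = ⊥-elim (All.lookup y∉ (zip-∈₂ xs ys m) refl)
    zip-partner-unique (x ∷ xs) (y ∷ ys) (y∉ ∷ u) (there m)   (here refl) = ⊥-elim (All.lookup y∉ (zip-∈₂ xs ys m) refl)
    zip-partner-unique (x ∷ xs) (y ∷ ys) (_ ∷ u)  (there m)   (there m′)  = zip-partner-unique xs ys u m m′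

module Sums where

  open import Data.Empty using (⊥-elim)
  open import Data.Nat using (ℕ; zero; suc; _≤_; _<_; z≤n; s≤s)
  import Data.Nat as Nat
  open import Data.Nat.Properties using (_≟_; suc-injective)
  open import Data.Integer using (ℤ; +_; _+_; _*_; _-_)
  import Data.Integer.Properties as ℤ
  open import Data.Integer.Tactic.RingSolver using (solve-∀)
  open import Data.List using (List; _++_; length; concat; concatMap; applyUpTo; upTo)
  open import Data.List.Properties using (length-++; map-applyUpTo)
  open import Function.Base using (_∘_; id)
  open import Function.Bundles using (_⇔_; mk⇔; Equivalence)
  open import Relation.Nullary using (Dec; yes; no; ¬_)
  open import Relation.Nullary.Decidable using (¬?; _×-dec_)
  open import Relation.Binary.PropositionalEquality using (_≡_; refl; sym; trans; cong; cong₂; module ≡-Reasoning)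

  ∑ : ℕ → (ℕ → ℤ) → ℤ
  ∑ zero    h = + 0
  ∑ (suc n) h = h 0 + ∑ n (h ∘ suc)

  when : {P : Set} → Dec P → ℤ → ℤ
  when (yes _) x = x
  when (no  _) x = + 0

  ∑-cong : ∀ n {h h′ : ℕ → ℤ} → (∀ i → i < n → h i ≡ h′ i) → ∑ n h ≡ ∑ n h′
  ∑-cong zero    eq = refl
  ∑-cong (suc n) eq = cong₂ _+_ (eq 0 (s≤s z≤n)) (∑-cong n (λ i lt → eq (suc i) (s≤s lt)))

  ∑-zero : ∀ n {h : ℕ → ℤ} → (∀ i → i < n → h i ≡ + 0) → ∑ n h ≡ + 0
  ∑-zero n eq = trans (∑-cong n eq) (zeros n)
    where
    zeros : ∀ n → ∑ n (λ _ → + 0) ≡ + 0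
    zeros zero    = refl
    zeros (suc n) = trans (ℤ.+-identityˡ _) (zeros n)

  ∑-+ : ∀ n (h h′ : ℕ → ℤ) → ∑ n (λ i → h i + h′ i) ≡ ∑ n h + ∑ n h′
  ∑-+ zero    h h′ = refl
  ∑-+ (suc n) h h′ rewrite ∑-+ n (h ∘ suc) (h′ ∘ suc) =
    interchange (h 0) (h′ 0) (∑ n (h ∘ suc)) (∑ n (h′ ∘ suc))
    where
    interchange : ∀ a b c d → (a + b) + (c + d) ≡ (a + c) + (b + d)
    interchange = solve-∀

  ∑-*ˡ : ∀ n c (h : ℕ → ℤ) → ∑ n (λ i → c * h i) ≡ c * ∑ n h
  ∑-*ˡ zero    c h = sym (ℤ.*-zeroʳ c)
  ∑-*ˡ (suc n) c h rewrite ∑-*ˡ n c (h ∘ suc) = sym (ℤ.*-distribˡ-+ c (h 0) _)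

  ∑-*ʳ : ∀ n c (h : ℕ → ℤ) → ∑ n (λ i → h i * c) ≡ ∑ n h * c
  ∑-*ʳ n c h = begin
    ∑ n (λ i → h i * c) ≡⟨ ∑-cong n (λ i _ → ℤ.*-comm (h i) c) ⟩
    ∑ n (λ i → c * h i) ≡⟨ ∑-*ˡ n c h ⟩
    c * ∑ n h           ≡⟨ ℤ.*-comm c (∑ n h) ⟩
    ∑ n h * c           ∎
    where open ≡-Reasoning

  ∑-swap : ∀ n m (h : ℕ → ℕ → ℤ) → ∑ n (λ a → ∑ m (h a)) ≡ ∑ m (λ r → ∑ n (λ a → h a r))
  ∑-swap zero    m h = sym (∑-zero m (λ _ _ → refl))
  ∑-swap (suc n) m h rewrite ∑-swap n m (h ∘ suc) = sym (∑-+ m (h 0) (λ r → ∑ n (λ a → h (suc a) r)))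

  ∑-extend : ∀ m n (h : ℕ → ℤ) → m ≤ n → (∀ i → m ≤ i → h i ≡ + 0) → ∑ n h ≡ ∑ m h
  ∑-extend zero    n       h _        vanish = ∑-zero n (λ i _ → vanish i z≤n)
  ∑-extend (suc m) (suc n) h (s≤s le) vanish =
    cong (λ s → h 0 + s) (∑-extend m n (h ∘ suc) le (λ i le′ → vanish (suc i) (s≤s le′)))

  when-yes : ∀ {P : Set} (P? : Dec P) {x} → P → when P? x ≡ x
  when-yes (yes _) _  = refl
  when-yes (no ¬p) p = ⊥-elim (¬p p)

  when-no : ∀ {P : Set} (P? : Dec P) {x} → ¬ P → when P? x ≡ + 0
  when-no (yes p) ¬p = ⊥-elim (¬p p)
  when-no (no _)  _  = refl

  when-cong : ∀ {P Q : Set} (P? : Dec P) (Q? : Dec Q) {x y} → P ⇔ Q → (P → Q → x ≡ y) → when P? x ≡ when Q? y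
  when-cong (yes p) (yes q) P⇔Q eq = eq p q
  when-cong (no  _) (no  _) P⇔Q eq = refl
  when-cong (yes p) (no ¬q) P⇔Q eq = ⊥-elim (¬q (Equivalence.to P⇔Q p))
  when-cong (no ¬p) (yes q) P⇔Q eq = ⊥-elim (¬p (Equivalence.from P⇔Q q))

  when-when : ∀ {P Q : Set} (P? : Dec P) (Q? : Dec Q) x → when P? (when Q? x) ≡ when (P? ×-dec Q?) x
  when-when (yes _) (yes _) x = refl
  when-when (yes _) (no  _) x = refl
  when-when (no  _) Q?      x = refl

  when-*ˡ : ∀ {P : Set} (P? : Dec P) c x → when P? (c * x) ≡ c * when P? x
  when-*ˡ (yes _) c x = refl
  when-*ˡ (no  _) c x = sym (ℤ.*-zeroʳ c)

  ∑-pick : ∀ n a (h : ℕ → ℤ) → a < n → ∑ n h ≡ h a + ∑ n (λ i → when (¬? (i ≟ a)) (h i))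
  ∑-pick (suc n) zero    h _        = cong (λ s → h 0 + s) (trans (∑-cong n (λ i _ → refl)) (sym (ℤ.+-identityˡ _)))
  ∑-pick (suc n) (suc a) h (s≤s lt) = begin
    h 0 + ∑ n (h ∘ suc)                                                        ≡⟨ cong (λ s → h 0 + s) (∑-pick n a (h ∘ suc) lt) ⟩
    h 0 + (h (suc a) + ∑ n (λ i → when (¬? (i ≟ a)) (h (suc i))))               ≡⟨ exchange (h 0) (h (suc a)) _ ⟩
    h (suc a) + (h 0 + ∑ n (λ i → when (¬? (i ≟ a)) (h (suc i))))               ≡⟨ cong (λ s → h (suc a) + (h 0 + s)) (∑-cong n shifted) ⟩
    h (suc a) + (h 0 + ∑ n (λ i → when (¬? (suc i ≟ suc a)) (h (suc i))))       ∎
    where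
    open ≡-Reasoning
    exchange : ∀ x y z → x + (y + z) ≡ y + (x + z)
    exchange = solve-∀
    shifted : ∀ i → i < n → when (¬? (i ≟ a)) (h (suc i)) ≡ when (¬? (suc i ≟ suc a)) (h (suc i))
    shifted i _ = when-cong (¬? (i ≟ a)) (¬? (suc i ≟ suc a)) (mk⇔ (λ i≢a → i≢a ∘ suc-injective) (λ i+1≢ → i+1≢ ∘ cong suc)) (λ _ _ → refl)

  ∑-telescope : ∀ n (p : ℕ → ℕ) → ∑ n (λ j → + p (suc j) - + p j) ≡ + p n - + p 0
  ∑-telescope zero    p = sym (ℤ.+-inverseʳ (+ p 0))
  ∑-telescope (suc n) p rewrite ∑-telescope n (p ∘ suc) = collapse (+ p (suc n)) (+ p 1) (+ p 0)
    where
    collapse : ∀ x y z → y - z + (x - y) ≡ x - z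
    collapse = solve-∀

  length-concatMap-upTo : ∀ {A : Set} n (F : ℕ → List A) → + length (concatMap F (upTo n)) ≡ ∑ n (λ r → + length (F r))
  length-concatMap-upTo n F = trans (cong (λ Fs → + length (concat Fs)) (map-applyUpTo id F n)) (concatenated n F)
    where
    concatenated : ∀ {A : Set} n (F : ℕ → List A) → + length (concat (applyUpTo F n)) ≡ ∑ n (λ r → + length (F r))
    concatenated zero    F = refl
    concatenated (suc n) F = begin
      + length (F 0 ++ concat (applyUpTo (F ∘ suc) n))                    ≡⟨ cong +_ (length-++ (F 0)) ⟩
      + (length (F 0) Nat.+ length (concat (applyUpTo (F ∘ suc) n)))      ≡⟨ ℤ.pos-+ (length (F 0)) _ ⟩
      + length (F 0) + + length (concat (applyUpTo (F ∘ suc) n))          ≡⟨ cong (λ s → + length (F 0) + s) (concatenated n (F ∘ suc)) ⟩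
      ∑ (suc n) (λ r → + length (F r))                                    ∎
      where open ≡-Reasoning

module Partitions where

  open import Data.Empty using (⊥-elim)
  open import Data.Unit using (⊤; tt)
  open import Data.Nat using (ℕ; zero; suc; _+_; _∸_; _≤_; _<_; _≥_; z≤n; s≤s; pred; >-nonZero; >-nonZero⁻¹)
  open import Data.Nat.Properties using (_≟_; _<?_; +-comm; +-identityʳ; +-suc; 0∸n≡0; 1+n≢n; <-irrefl; <-≤-trans; <⇒≤pred; m+n∸n≡m; m∸n+n≡m; m∸n≤m; m≤m+n; n≤1+n; pred-cancel-<; ≤-refl; ≤-reflexive; ≤-trans)
  open import Data.Product using (_×_; _,_; proj₁; proj₂)
  open import Data.List using (List; []; _∷_; [_]; length)
  open import Data.List.Relation.Unary.All using (All; []; _∷_)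
  open import Data.List.Relation.Unary.Linked as Linked using (Linked; []; [-]; _∷_)
  open import Function.Base using (_∘_)
  open import Function.Bundles using (_⇔_; mk⇔; Equivalence)
  open import Relation.Nullary using (Dec; yes; no)
  open import Relation.Binary.PropositionalEquality using (_≡_; _≢_; refl; sym; trans; cong; cong₂; subst₂; module ≡-Reasoning)

  δ : ℕ → ℕ → ℕ
  δ zero    zero    = 1
  δ zero    (suc r) = 0
  δ (suc i) zero    = 0
  δ (suc i) (suc r) = δ i r

  δ-self : ∀ i → δ i i ≡ 1
  δ-self zero    = refl
  δ-self (suc i) = δ-self i

  δ-≢ : ∀ i r → i ≢ r → δ i r ≡ 0
  δ-≢ zero    zero    i≢r = ⊥-elim (i≢r refl)
  δ-≢ zero    (suc r) _   = refl
  δ-≢ (suc i) zero    _   = refl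
  δ-≢ (suc i) (suc r) i≢r = δ-≢ i r (i≢r ∘ cong suc)

  nonzeroRow : ℕ → List ℕ
  nonzeroRow zero    = []
  nonzeroRow (suc k) = [ suc k ]

  removeBox : List ℕ → ℕ → List ℕ
  removeBox []           r       = []
  removeBox (x ∷ xs)     (suc r) = x ∷ removeBox xs r
  removeBox (x ∷ [])     zero    = nonzeroRow (pred x)
  removeBox (x ∷ y ∷ ys) zero    = pred x ∷ y ∷ ys

  part-addBox : ∀ ν a i → a ≤ length ν → part (addBox ν a) i ≡ part ν i + δ i a
  part-addBox []       zero    zero    _       = refl
  part-addBox []       zero    (suc i) _       = refl
  part-addBox (x ∷ xs) zero    zero    _       = +-comm 1 x
  part-addBox (x ∷ xs) zero    (suc i) _       = sym (+-identityʳ _)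
  part-addBox (x ∷ xs) (suc a) zero    _       = sym (+-identityʳ x)
  part-addBox (x ∷ xs) (suc a) (suc i) (s≤s a≤) = part-addBox xs a i a≤

  part-removeBox : ∀ ν r i → part (removeBox ν r) i ≡ part ν i ∸ δ i r
  part-removeBox []           r       i       = sym (0∸n≡0 (δ i r))
  part-removeBox (x ∷ xs)     (suc r) zero    = refl
  part-removeBox (x ∷ xs)     (suc r) (suc i) = part-removeBox xs r i
  part-removeBox (x ∷ [])     zero    zero    = lastRow (pred x)
    where
    lastRow : ∀ k → part (nonzeroRow k) 0 ≡ k
    lastRow zero    = refl
    lastRow (suc k) = refl
  part-removeBox (x ∷ [])     zero    (suc i) = beyond (pred x)
    where
    beyond : ∀ k → part (nonzeroRow k) (suc i) ≡ 0
    beyond zero    = refl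
    beyond (suc k) = refl
  part-removeBox (x ∷ y ∷ ys) zero    zero    = refl
  part-removeBox (x ∷ y ∷ ys) zero    (suc i) = refl

  size-addBox : ∀ ν a → a ≤ length ν → size (addBox ν a) ≡ suc (size ν)
  size-addBox []       zero    _        = refl
  size-addBox (x ∷ xs) zero    _        = refl
  size-addBox (x ∷ xs) (suc a) (s≤s a≤) = trans (cong (x +_) (size-addBox xs a a≤)) (+-suc x _)

  size-removeBox : ∀ ν r → 0 < part ν r → suc (size (removeBox ν r)) ≡ size ν
  size-removeBox (x ∷ xs)         (suc r) pos = trans (sym (+-suc x _)) (cong (x +_) (size-removeBox xs r pos))
  size-removeBox (suc x ∷ [])     zero    _   = cong suc (lastRow x)
    where
    lastRow : ∀ k → size (nonzeroRow k) ≡ k + 0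
    lastRow zero    = refl
    lastRow (suc k) = refl
  size-removeBox (suc x ∷ y ∷ ys) zero    _   = refl

  part>0⇒<length : ∀ ν i → 0 < part ν i → i < length ν
  part>0⇒<length (x ∷ xs) zero    _   = s≤s z≤n
  part>0⇒<length (x ∷ xs) (suc i) pos = s≤s (part>0⇒<length xs i pos)

  Corner : List ℕ → ℕ → Set
  Corner ν r = part ν (suc r) < part ν r

  corner? : ∀ ν r → Dec (Corner ν r)
  corner? ν r = part ν (suc r) <? part ν r

  Addable : List ℕ → ℕ → Set
  Addable ν zero    = ⊤
  Addable ν (suc a) = Corner ν a

  addable? : ∀ ν a → Dec (Addable ν a)
  addable? ν zero    = yes tt
  addable? ν (suc a) = corner? ν a

  corner⇒part>0 : ∀ ν r → Corner ν r → 0 < part ν r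
  corner⇒part>0 ν r c = ≤-trans (s≤s z≤n) c

  corner⇒<length : ∀ ν r → Corner ν r → r < length ν
  corner⇒<length ν r c = part>0⇒<length ν r (corner⇒part>0 ν r c)

  addable⇒≤length : ∀ ν a → Addable ν a → a ≤ length ν
  addable⇒≤length ν zero    _ = z≤n
  addable⇒≤length ν (suc a) c = corner⇒<length ν a c

  Monotone : List ℕ → Set
  Monotone ν = ∀ i → part ν (suc i) ≤ part ν i

  linked⇒monotone : ∀ {ν} → Linked _≥_ ν → Monotone ν
  linked⇒monotone {[]}         _         i       = z≤n
  linked⇒monotone {x ∷ []}     _         i       = z≤n
  linked⇒monotone {x ∷ y ∷ ys} (x≥y ∷ _) zero    = x≥y
  linked⇒monotone {x ∷ y ∷ ys} (_ ∷ l)   (suc i) = linked⇒monotone l i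

  monotone⇒linked : ∀ ν → Monotone ν → Linked _≥_ ν
  monotone⇒linked []           _    = []
  monotone⇒linked (x ∷ [])     _    = [-]
  monotone⇒linked (x ∷ y ∷ ys) mono = mono 0 ∷ monotone⇒linked (y ∷ ys) (mono ∘ suc)

  partition-monotone : ∀ {ν} → IsPartition ν → Monotone ν
  partition-monotone (linked , _) = linked⇒monotone linked

  partition-tail : ∀ {x xs} → IsPartition (x ∷ xs) → IsPartition xs
  partition-tail (linked , _ ∷ pos) = Linked.tail linked , pos

  partition-positive : ∀ {ν} → IsPartition ν → ∀ i → i < length ν → 0 < part ν i
  partition-positive {x ∷ xs} (_ , pos ∷ _) zero    _        = >-nonZero⁻¹ x {{pos}}
  partition-positive {x ∷ xs} P             (suc i) (s≤s lt) = partition-positive (partition-tail P) i lt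

  partition-ext : ∀ {ν μ} → IsPartition ν → IsPartition μ → (∀ i → part ν i ≡ part μ i) → ν ≡ μ
  partition-ext {[]}     {[]}     _ _ _  = refl
  partition-ext {[]}     {y ∷ ys} _ Q eq = ⊥-elim (<-irrefl (eq 0) (partition-positive Q 0 (s≤s z≤n)))
  partition-ext {x ∷ xs} {[]}     P _ eq = ⊥-elim (<-irrefl (sym (eq 0)) (partition-positive P 0 (s≤s z≤n)))
  partition-ext {x ∷ xs} {y ∷ ys} P Q eq =
    cong₂ _∷_ (eq 0) (partition-ext (partition-tail P) (partition-tail Q) (eq ∘ suc))

  addBox-positive : ∀ ν a → All Positive ν → All Positive (addBox ν a)
  addBox-positive []       zero    _        = _ ∷ []
  addBox-positive []       (suc a) _        = []
  addBox-positive (x ∷ xs) zero    (_ ∷ ps) = _ ∷ ps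
  addBox-positive (x ∷ xs) (suc a) (p ∷ ps) = p ∷ addBox-positive xs a ps

  removeBox-positive : ∀ ν r → All Positive ν → Corner ν r → All Positive (removeBox ν r)
  removeBox-positive []           r       _             _ = []
  removeBox-positive (x ∷ xs)     (suc r) (p ∷ ps)      c = p ∷ removeBox-positive xs r ps c
  removeBox-positive (x ∷ [])     zero    _             _ = lastRow (pred x)
    where
    lastRow : ∀ k → All Positive (nonzeroRow k)
    lastRow zero    = []
    lastRow (suc k) = _ ∷ []
  removeBox-positive (x ∷ y ∷ ys) zero    (_ ∷ py ∷ ps) c =
    >-nonZero (≤-trans (>-nonZero⁻¹ y {{py}}) (<⇒≤pred c)) ∷ py ∷ ps

  addBox-partition : ∀ ν a → IsPartition ν → Addable ν a → IsPartition (addBox ν a)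
  addBox-partition ν a P@(_ , pos) add =
    monotone⇒linked (addBox ν a) mono , addBox-positive ν a pos
    where
    a≤ : a ≤ length ν
    a≤ = addable⇒≤length ν a add
    step : ∀ i → part ν (suc i) + δ (suc i) a ≤ part ν i + δ i a
    step i with suc i ≟ a
    ... | yes refl rewrite δ-self (suc i) = ≤-trans (≤-reflexive (+-comm _ 1)) (≤-trans add (m≤m+n _ _))
    ... | no i+1≢a rewrite δ-≢ (suc i) a i+1≢a =
      ≤-trans (≤-reflexive (+-identityʳ _)) (≤-trans (partition-monotone P i) (m≤m+n _ _))
    mono : Monotone (addBox ν a)
    mono i = subst₂ _≤_ (sym (part-addBox ν a (suc i) a≤)) (sym (part-addBox ν a i a≤)) (step i)

  removeBox-partition : ∀ ν r → IsPartition ν → Corner ν r → IsPartition (removeBox ν r)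
  removeBox-partition ν r P@(_ , pos) c =
    monotone⇒linked (removeBox ν r) mono , removeBox-positive ν r pos c
    where
    step : ∀ i → part ν (suc i) ∸ δ (suc i) r ≤ part ν i ∸ δ i r
    step i with i ≟ r
    ... | yes refl rewrite δ-self i = ≤-trans (m∸n≤m _ (δ (suc i) i)) (<⇒≤pred c)
    ... | no i≢r rewrite δ-≢ i r i≢r = ≤-trans (m∸n≤m _ (δ (suc i) r)) (partition-monotone P i)
    mono : Monotone (removeBox ν r)
    mono i = subst₂ _≤_ (sym (part-removeBox ν r (suc i))) (sym (part-removeBox ν r i)) (step i)

  addBox-partition⁻ : ∀ ν a → a ≤ length ν → IsPartition (addBox ν a) → Addable ν a
  addBox-partition⁻ ν zero    _  _ = tt
  addBox-partition⁻ ν (suc a) a≤ Q = subst₂ _≤_ grown kept (partition-monotone Q a)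
    where
    grown : part (addBox ν (suc a)) (suc a) ≡ suc (part ν (suc a))
    grown = trans (part-addBox ν (suc a) (suc a) a≤) (trans (cong (part ν (suc a) +_) (δ-self a)) (+-comm _ 1))
    kept : part (addBox ν (suc a)) a ≡ part ν a
    kept = trans (part-addBox ν (suc a) a a≤) (trans (cong (part ν a +_) (δ-≢ a (suc a) (1+n≢n ∘ sym))) (+-identityʳ _))

  corner-addBox : ∀ ν a → IsPartition ν → Addable ν a → Corner (addBox ν a) a
  corner-addBox ν a P add = subst₂ _<_ (sym below) (sym at) (s≤s (partition-monotone P a))
    where
    a≤ : a ≤ length ν
    a≤ = addable⇒≤length ν a add
    below : part (addBox ν a) (suc a) ≡ part ν (suc a)
    below = trans (part-addBox ν a (suc a) a≤) (trans (cong (part ν (suc a) +_) (δ-≢ (suc a) a 1+n≢n)) (+-identityʳ _))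
    at : part (addBox ν a) a ≡ suc (part ν a)
    at = trans (part-addBox ν a a a≤) (trans (cong (part ν a +_) (δ-self a)) (+-comm _ 1))

  removeBox-addBox : ∀ ν a → IsPartition ν → Addable ν a → removeBox (addBox ν a) a ≡ ν
  removeBox-addBox ν a P add =
    partition-ext (removeBox-partition (addBox ν a) a (addBox-partition ν a P add) (corner-addBox ν a P add)) P
      (λ i → trans (part-removeBox (addBox ν a) a i)
               (trans (cong (_∸ δ i a) (part-addBox ν a i (addable⇒≤length ν a add))) (m+n∸n≡m _ (δ i a))))

  addable-removeBox : ∀ ν r → IsPartition ν → Corner ν r → Addable (removeBox ν r) r
  addable-removeBox ν zero    P c = tt
  addable-removeBox ν (suc r) P c
    rewrite part-removeBox ν (suc r) (suc r) | part-removeBox ν (suc r) r | δ-self r | δ-≢ r (suc r) (1+n≢n ∘ sym) =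
    <-≤-trans (pred< (corner⇒part>0 ν (suc r) c)) (partition-monotone P r)
    where
    pred< : ∀ {n} → 0 < n → pred n < n
    pred< {suc n} _ = ≤-refl

  addBox-removeBox : ∀ ν r → IsPartition ν → Corner ν r → addBox (removeBox ν r) r ≡ ν
  addBox-removeBox ν r P c =
    partition-ext (addBox-partition (removeBox ν r) r (removeBox-partition ν r P c) add) P
      (λ i → trans (part-addBox (removeBox ν r) r i (addable⇒≤length _ r add))
               (trans (cong (_+ δ i r) (part-removeBox ν r i)) (restore i)))
    where
    add : Addable (removeBox ν r) r
    add = addable-removeBox ν r P c
    restore : ∀ i → part ν i ∸ δ i r + δ i r ≡ part ν i
    restore i with i ≟ r
    ... | yes refl rewrite δ-self i = m∸n+n≡m (corner⇒part>0 ν i c)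
    ... | no i≢r  rewrite δ-≢ i r i≢r = +-identityʳ (part ν i)

  addable-corner-swap : ∀ ν a r → a ≢ r → a ≤ length ν →
    (Addable ν a × Corner (addBox ν a) r) ⇔ (Corner ν r × Addable (removeBox ν r) a)
  addable-corner-swap ν zero r 0≢r a≤
    rewrite part-addBox ν 0 (suc r) a≤ | part-addBox ν 0 r a≤ | δ-≢ r 0 (0≢r ∘ sym)
          | +-identityʳ (part ν (suc r)) | +-identityʳ (part ν r)
    = mk⇔ (λ (_ , c) → c , tt) (λ (c , _) → tt , c)
  addable-corner-swap ν (suc j) r a≢r a≤ with j ≟ r
  ... | yes refl
    rewrite part-addBox ν (suc j) (suc j) a≤ | part-addBox ν (suc j) j a≤
          | part-removeBox ν j (suc j) | part-removeBox ν j j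
          | δ-self j | δ-≢ j (suc j) (1+n≢n ∘ sym) | δ-≢ (suc j) j 1+n≢n
          | +-identityʳ (part ν j) | +-comm (part ν (suc j)) 1
    = mk⇔ (λ (add , c) → add , <⇒≤pred c) (λ (c , add) → c , pred-cancel-< add)
  ... | no j≢r
    rewrite part-addBox ν (suc j) (suc r) a≤ | part-addBox ν (suc j) r a≤
          | part-removeBox ν r (suc j) | part-removeBox ν r j
          | δ-≢ r j (j≢r ∘ sym) | δ-≢ r (suc j) (a≢r ∘ sym) | δ-≢ (suc j) r a≢r | δ-≢ j r j≢r
          | +-identityʳ (part ν (suc r)) | +-identityʳ (part ν r)
    = mk⇔ (λ (add , c) → c , add) (λ (c , add) → add , c)

  removeBox-addBox-comm : ∀ ν a r → IsPartition ν → a ≢ r → Addable ν a → Corner (addBox ν a) r →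
    removeBox (addBox ν a) r ≡ addBox (removeBox ν r) a
  removeBox-addBox-comm ν a r P a≢r add c′ =
    partition-ext (removeBox-partition (addBox ν a) r (addBox-partition ν a P add) c′)
                  (addBox-partition (removeBox ν r) a (removeBox-partition ν r P c) add′) same-rows
    where
    a≤ : a ≤ length ν
    a≤ = addable⇒≤length ν a add
    swapped : Corner ν r × Addable (removeBox ν r) a
    swapped = Equivalence.to (addable-corner-swap ν a r a≢r a≤) (add , c′)
    c : Corner ν r
    c = proj₁ swapped
    add′ : Addable (removeBox ν r) a
    add′ = proj₂ swapped
    shift : ∀ i → part ν i + δ i a ∸ δ i r ≡ part ν i ∸ δ i r + δ i a
    shift i with i ≟ a
    ... | yes refl rewrite δ-≢ i r a≢r = refl
    ... | no i≢a   rewrite δ-≢ i a i≢a | +-identityʳ (part ν i) | +-identityʳ (part ν i ∸ δ i r) = refl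
    same-rows : ∀ i → part (removeBox (addBox ν a) r) i ≡ part (addBox (removeBox ν r) a) i
    same-rows i = begin
      part (removeBox (addBox ν a) r) i ≡⟨ part-removeBox (addBox ν a) r i ⟩
      part (addBox ν a) i ∸ δ i r       ≡⟨ cong (_∸ δ i r) (part-addBox ν a i a≤) ⟩
      part ν i + δ i a ∸ δ i r          ≡⟨ shift i ⟩
      part ν i ∸ δ i r + δ i a          ≡⟨ cong (_+ δ i a) (sym (part-removeBox ν r i)) ⟩
      part (removeBox ν r) i + δ i a    ≡⟨ sym (part-addBox (removeBox ν r) a i (addable⇒≤length _ a add′)) ⟩
      part (addBox (removeBox ν r) a) i ∎
      where open ≡-Reasoning

  length-addBox : ∀ ν a → length (addBox ν a) ≤ suc (length ν)
  length-addBox []       zero    = ≤-refl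
  length-addBox []       (suc a) = z≤n
  length-addBox (x ∷ xs) zero    = n≤1+n _
  length-addBox (x ∷ xs) (suc a) = s≤s (length-addBox xs a)

  length-removeBox : ∀ ν r → length (removeBox ν r) ≤ length ν
  length-removeBox []           r       = z≤n
  length-removeBox (x ∷ xs)     (suc r) = s≤s (length-removeBox xs r)
  length-removeBox (x ∷ [])     zero    = lastRow (pred x)
    where
    lastRow : ∀ k → length (nonzeroRow k) ≤ 1
    lastRow zero    = z≤n
    lastRow (suc k) = ≤-refl
  length-removeBox (x ∷ y ∷ ys) zero    = ≤-refl

  part-length : ∀ ν → part ν (length ν) ≡ 0
  part-length []       = refl
  part-length (x ∷ xs) = part-length xs

module Cells where

  open Lists
  open Partitions
  open import Data.Nat using (ℕ; zero; suc; _+_; _∸_; _≤_; _<_; z≤n; pred)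
  open import Data.Nat.Properties using (+-identityʳ; +-suc; +-monoʳ-≤; m≤m+n)
  open import Data.Product using (_×_; _,_; ∃)
  open import Data.Sum using (inj₁; inj₂)
  open import Data.List using (List; []; _∷_; [_]; _++_; map; upTo; length)
  open import Data.List.Properties using (map-++; ++-assoc; length-++; length-map; length-upTo; upTo-∷ʳ)
  open import Data.List.Membership.Propositional using (_∈_)
  open import Data.List.Membership.Propositional.Properties using (∈-++⁺ˡ; ∈-++⁺ʳ; ∈-++⁻; ∈-map⁺; ∈-map⁻; ∈-upTo⁺; ∈-upTo⁻)
  open import Relation.Binary.PropositionalEquality using (_≡_; refl; sym; trans; cong; cong₂; module ≡-Reasoning)

  row : ℕ → ℕ → List (ℕ × ℕ)
  row i x = map (i ,_) (upTo x)

  length-row : ∀ i x → length (row i x) ≡ x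
  length-row i x = trans (length-map (i ,_) (upTo x)) (length-upTo x)

  ∈-cellsFrom⁻ : ∀ s ν {i j} → (i , j) ∈ cellsFrom s ν → ∃ λ k → i ≡ s + k × j < part ν k
  ∈-cellsFrom⁻ s (x ∷ xs) c∈ with ∈-++⁻ (row s x) c∈
  ... | inj₁ c∈row with ∈-map⁻ (s ,_) c∈row
  ...   | j , j∈ , refl = 0 , sym (+-identityʳ s) , ∈-upTo⁻ j∈
  ∈-cellsFrom⁻ s (x ∷ xs) c∈ | inj₂ c∈rest with ∈-cellsFrom⁻ (suc s) xs c∈rest
  ... | k , refl , lt = suc k , sym (+-suc s k) , lt

  ∈-cellsFrom⁺ : ∀ s ν k {j} → j < part ν k → (s + k , j) ∈ cellsFrom s ν
  ∈-cellsFrom⁺ s (x ∷ xs) zero    {j} lt rewrite +-identityʳ s = ∈-++⁺ˡ (∈-map⁺ (s ,_) (∈-upTo⁺ lt))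
  ∈-cellsFrom⁺ s (x ∷ xs) (suc k) {j} lt rewrite +-suc s k = ∈-++⁺ʳ (row s x) (∈-cellsFrom⁺ (suc s) xs k lt)

  ∈-cells⁻ : ∀ ν {i j} → (i , j) ∈ cells ν → j < part ν i
  ∈-cells⁻ ν c∈ with ∈-cellsFrom⁻ 0 ν c∈
  ... | k , refl , lt = lt

  ∈-cells⁺ : ∀ ν {i j} → j < part ν i → (i , j) ∈ cells ν
  ∈-cells⁺ ν {i} lt = ∈-cellsFrom⁺ 0 ν i lt

  length-cellsFrom : ∀ s ν → length (cellsFrom s ν) ≡ size ν
  length-cellsFrom s []       = refl
  length-cellsFrom s (x ∷ xs) = trans (length-++ (row s x)) (cong₂ _+_ (length-row s x) (length-cellsFrom (suc s) xs))

  -- The last cell of row r (meaningful when row r is nonempty).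
  lastCell : List ℕ → ℕ → ℕ × ℕ
  lastCell ν r = (r , part ν r ∸ 1)

  cornerIndex : List ℕ → ℕ → ℕ
  cornerIndex []       r       = 0
  cornerIndex (x ∷ xs) zero    = pred x
  cornerIndex (x ∷ xs) (suc r) = x + cornerIndex xs r

  cellsFrom-removeBox : ∀ s ν r → 0 < part ν r →
    cellsFrom s ν ≡ insertAt (cornerIndex ν r) (s + r , part ν r ∸ 1) (cellsFrom s (removeBox ν r))
  cellsFrom-removeBox s (x ∷ xs) (suc r) pos = begin
    row s x ++ cellsFrom (suc s) xs
      ≡⟨ cong (row s x ++_) (cellsFrom-removeBox (suc s) xs r pos) ⟩
    row s x ++ insertAt (cornerIndex xs r) (suc s + r , part xs r ∸ 1) (cellsFrom (suc s) (removeBox xs r))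
      ≡⟨ sym (insertAt-++ (row s x) (cornerIndex xs r) _ _) ⟩
    insertAt (length (row s x) + cornerIndex xs r) (suc s + r , part xs r ∸ 1) (row s x ++ cellsFrom (suc s) (removeBox xs r))
      ≡⟨ cong₂ (λ p i → insertAt (p + cornerIndex xs r) (i , part xs r ∸ 1) (row s x ++ cellsFrom (suc s) (removeBox xs r)))
               (length-row s x) (sym (+-suc s r)) ⟩
    insertAt (x + cornerIndex xs r) (s + suc r , part xs r ∸ 1) (row s x ++ cellsFrom (suc s) (removeBox xs r))
      ∎
    where open ≡-Reasoning
  cellsFrom-removeBox s (suc x ∷ xs) zero _ = begin
    row s (suc x) ++ cellsFrom (suc s) xs
      ≡⟨ cong (λ cs → map (s ,_) cs ++ cellsFrom (suc s) xs) (sym (upTo-∷ʳ x)) ⟩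
    map (s ,_) (upTo x ++ [ x ]) ++ cellsFrom (suc s) xs
      ≡⟨ cong (_++ cellsFrom (suc s) xs) (map-++ (s ,_) (upTo x) [ x ]) ⟩
    (row s x ++ [ (s , x) ]) ++ cellsFrom (suc s) xs
      ≡⟨ ++-assoc (row s x) _ _ ⟩
    row s x ++ (s , x) ∷ cellsFrom (suc s) xs
      ≡⟨ sym (insertAt-++ (row s x) 0 _ _) ⟩
    insertAt (length (row s x) + 0) (s , x) (row s x ++ cellsFrom (suc s) xs)
      ≡⟨ cong₂ (λ p i → insertAt p (i , x) (row s x ++ cellsFrom (suc s) xs))
               (trans (+-identityʳ _) (length-row s x)) (sym (+-identityʳ s)) ⟩
    insertAt x (s + 0 , x) (row s x ++ cellsFrom (suc s) xs)
      ≡⟨ cong (insertAt x (s + 0 , x)) (sym (shortened xs)) ⟩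
    insertAt x (s + 0 , x) (cellsFrom s (removeBox (suc x ∷ xs) 0))
      ∎
    where
    open ≡-Reasoning
    shortened : ∀ xs → cellsFrom s (removeBox (suc x ∷ xs) 0) ≡ row s x ++ cellsFrom (suc s) xs
    shortened (y ∷ ys) = refl
    shortened []       = lastRow x
      where
      lastRow : ∀ k → cellsFrom s (nonzeroRow k) ≡ row s k ++ []
      lastRow zero    = refl
      lastRow (suc k) = refl

  cornerIndex≤size : ∀ ν r → 0 < part ν r → cornerIndex ν r ≤ size (removeBox ν r)
  cornerIndex≤size (x ∷ xs)         (suc r) pos = +-monoʳ-≤ x (cornerIndex≤size xs r pos)
  cornerIndex≤size (suc x ∷ [])     zero    _   = lastRow x
    where
    lastRow : ∀ k → k ≤ size (nonzeroRow k)
    lastRow zero    = z≤n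
    lastRow (suc k) = m≤m+n (suc k) 0
  cornerIndex≤size (suc x ∷ y ∷ ys) zero    _   = m≤m+n x _

module Tableaux where

  open Lists
  open import Data.Bool using (Bool; true; false; T; not; _∧_; _∨_)
  open import Data.Bool.Properties using (T-∧; T-∨)
  open import Data.Unit using (tt)
  open import Data.Nat using (ℕ; zero; suc; _<_; _<ᵇ_; _≡ᵇ_)
  open import Data.Nat.Properties using (≡ᵇ⇒≡; ≡⇒≡ᵇ; <ᵇ⇒<; <⇒<ᵇ; suc-injective)
  open import Data.Product using (_×_; _,_; proj₁; proj₂)
  open import Data.Sum using (inj₁; inj₂)
  open import Data.List using (List; []; _∷_; map; upTo; length; zip; filterᵇ)
  open import Data.List.Properties using (∷-injectiveˡ; ∷-injectiveʳ)
  open import Data.List.Relation.Unary.All as All using (All; []; _∷_)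
  open import Data.List.Relation.Unary.All.Properties using (¬Any⇒All¬; All¬⇒¬Any)
  open import Data.List.Relation.Unary.Any using (here; there)
  open import Data.List.Relation.Unary.AllPairs using ([]; _∷_)
  open import Data.List.Relation.Unary.Unique.Propositional using (Unique)
  import Data.List.Relation.Unary.Unique.Propositional.Properties as Unique
  open import Data.List.Membership.Propositional using (_∈_; find; lose)
  open import Data.List.Membership.Propositional.Properties using (∈-map⁺; ∈-map⁻; ∈-upTo⁺; ∈-upTo⁻; ∈-concatMap⁺; ∈-concatMap⁻; ∈-filter⁺; ∈-filter⁻)
  open import Function.Base using (_∘_)
  open import Function.Bundles using (_⇔_; mk⇔; Equivalence)
  open import Relation.Nullary using (¬_)
  open import Relation.Nullary.Decidable using (T?)
  open import Relation.Binary.PropositionalEquality using (_≡_; refl; cong)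

  open Equivalence using (to; from)

  T-not⇔¬T : ∀ b → T (not b) ⇔ (¬ T b)
  T-not⇔¬T false = mk⇔ (λ _ ()) (λ _ → tt)
  T-not⇔¬T true  = mk⇔ (λ ()) (λ ¬t → ¬t tt)

  T-implication : ∀ b c → T (not b ∨ c) ⇔ (T b → T c)
  T-implication false c = mk⇔ (λ _ ()) (λ _ → tt)
  T-implication true  c = mk⇔ (λ t _ → t) (λ imp → imp tt)

  elemᵇ⇔∈ : ∀ x xs → T (elemᵇ x xs) ⇔ x ∈ xs
  elemᵇ⇔∈ x []       = mk⇔ (λ ()) (λ ())
  elemᵇ⇔∈ x (y ∷ ys) = mk⇔ decode encode
    where
    decode : T ((x ≡ᵇ y) ∨ elemᵇ x ys) → x ∈ y ∷ ys
    decode t with to T-∨ t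
    ... | inj₁ x≡y = here (≡ᵇ⇒≡ x y x≡y)
    ... | inj₂ x∈  = there (to (elemᵇ⇔∈ x ys) x∈)
    encode : x ∈ y ∷ ys → T ((x ≡ᵇ y) ∨ elemᵇ x ys)
    encode (here refl) = from T-∨ (inj₁ (≡⇒≡ᵇ x x refl))
    encode (there x∈)  = from T-∨ (inj₂ (from (elemᵇ⇔∈ x ys) x∈))

  distinctᵇ⇔Unique : ∀ xs → T (distinctᵇ xs) ⇔ Unique xs
  distinctᵇ⇔Unique []       = mk⇔ (λ _ → []) (λ _ → tt)
  distinctᵇ⇔Unique (x ∷ xs) = mk⇔ decode encode
    where
    decode : T (not (elemᵇ x xs) ∧ distinctᵇ xs) → Unique (x ∷ xs)
    decode t with to T-∧ t
    ... | fresh , rest = ¬Any⇒All¬ xs (to (T-not⇔¬T _) fresh ∘ from (elemᵇ⇔∈ x xs)) ∷ to (distinctᵇ⇔Unique xs) rest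
    encode : Unique (x ∷ xs) → T (not (elemᵇ x xs) ∧ distinctᵇ xs)
    encode (x∉ ∷ u) = from T-∧ (from (T-not⇔¬T _) (All¬⇒¬Any x∉ ∘ to (elemᵇ⇔∈ x xs)) , from (distinctᵇ⇔Unique xs) u)

  allᵇ⇔All : ∀ {A : Set} (p : A → Bool) xs → T (allᵇ p xs) ⇔ All (T ∘ p) xs
  allᵇ⇔All p []       = mk⇔ (λ _ → []) (λ _ → tt)
  allᵇ⇔All p (x ∷ xs) = mk⇔
    (λ t → proj₁ (to T-∧ t) ∷ to (allᵇ⇔All p xs) (proj₂ (to T-∧ t)))
    (λ { (px ∷ pxs) → from T-∧ (px , from (allᵇ⇔All p xs) pxs) })

  Filling : Set
  Filling = List ((ℕ × ℕ) × ℕ)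

  Increasing : Filling → Set
  Increasing F = ∀ {c a d b} → (c , a) ∈ F → (d , b) ∈ F → T (adjacentᵇ c d) → a < b

  increasingᵇ⇔Increasing : ∀ F → T (increasingᵇ F) ⇔ Increasing F
  increasingᵇ⇔Increasing F = mk⇔ decode encode
    where
    decode : T (increasingᵇ F) → Increasing F
    decode t ca∈ db∈ adj =
      <ᵇ⇒< _ _ (to (T-implication _ _) (All.lookup (to (allᵇ⇔All _ F) (All.lookup (to (allᵇ⇔All _ F) t) ca∈)) db∈) adj)
    encode : Increasing F → T (increasingᵇ F)
    encode inc = from (allᵇ⇔All _ F) (All.tabulate λ ca∈ →
                 from (allᵇ⇔All _ F) (All.tabulate λ db∈ →
                 from (T-implication _ _) (λ adj → <⇒<ᵇ (inc ca∈ db∈ adj))))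

  record IsSYT (ν t : List ℕ) : Set where
    field
      length≡    : length t ≡ size ν
      bounded    : All (_< size ν) t
      distinct   : Unique t
      increasing : Increasing (zip (cells ν) t)

  allLists⇔ : ∀ k m xs → xs ∈ allLists k m ⇔ (length xs ≡ k × All (_< m) xs)
  allLists⇔ k m xs = mk⇔ (decode k xs) (λ (len , bnd) → encode k xs len bnd)
    where
    extend : ∀ k {x xs} → x < m → xs ∈ allLists k m → x ∷ xs ∈ allLists (suc k) m
    extend k x< xs∈ = ∈-concatMap⁺ (λ y → map (y ∷_) (allLists k m)) (lose (∈-upTo⁺ x<) (∈-map⁺ (_ ∷_) xs∈))
    encode : ∀ k xs → length xs ≡ k → All (_< m) xs → xs ∈ allLists k m
    encode zero    []       refl []         = here refl
    encode (suc k) (x ∷ xs) len  (x< ∷ xs<) = extend k x< (encode k xs (suc-injective len) xs<)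
    decode : ∀ k xs → xs ∈ allLists k m → length xs ≡ k × All (_< m) xs
    decode zero    [] _ = refl , []
    decode zero    (x ∷ xs) (there ())
    decode (suc k) xs xs∈ with find (∈-concatMap⁻ (λ y → map (y ∷_) (allLists k m)) {xs = upTo m} xs∈)
    ... | x , x∈ , xs∈′ with ∈-map⁻ (x ∷_) xs∈′
    ...   | ys , ys∈ , refl with decode k ys ys∈
    ...     | len , bnd = cong suc len , ∈-upTo⁻ x∈ ∷ bnd

  allLists-unique : ∀ k m → Unique (allLists k m)
  allLists-unique zero    m = [] ∷ []
  allLists-unique (suc k) m =
    concatMap-unique (λ x → map (x ∷_) (allLists k m)) (Unique.upTo⁺ m)
      (λ x → Unique.map⁺ ∷-injectiveʳ (allLists-unique k m)) sameHead
    where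
    sameHead : ∀ {x y v} → v ∈ map (x ∷_) (allLists k m) → v ∈ map (y ∷_) (allLists k m) → x ≡ y
    sameHead v∈ v∈′ with ∈-map⁻ _ v∈ | ∈-map⁻ _ v∈′
    ... | _ , _ , refl | _ , _ , eq = ∷-injectiveˡ eq

  SYTs : List ℕ → List (List ℕ)
  SYTs ν = filterᵇ (isSYTᵇ ν) (allLists (size ν) (size ν))

  ∈-SYTs⇔IsSYT : ∀ ν t → t ∈ SYTs ν ⇔ IsSYT ν t
  ∈-SYTs⇔IsSYT ν t = mk⇔ decode encode
    where
    decode : t ∈ SYTs ν → IsSYT ν t
    decode t∈ with ∈-filter⁻ (T? ∘ isSYTᵇ ν) {xs = allLists (size ν) (size ν)} t∈
    ... | t∈all , syt with to (allLists⇔ _ _ t) t∈all | to T-∧ syt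
    ...   | len , bnd | dist , incr = record
      { length≡ = len ; bounded = bnd
      ; distinct = to (distinctᵇ⇔Unique t) dist
      ; increasing = to (increasingᵇ⇔Increasing _) incr }
    encode : IsSYT ν t → t ∈ SYTs ν
    encode syt = ∈-filter⁺ (T? ∘ isSYTᵇ ν) (from (allLists⇔ _ _ t) (length≡ , bounded))
                   (from T-∧ (from (distinctᵇ⇔Unique t) distinct , from (increasingᵇ⇔Increasing _) increasing))
      where open IsSYT syt

  SYTs-unique : ∀ ν → Unique (SYTs ν)
  SYTs-unique ν = Unique.filter⁺ (T? ∘ isSYTᵇ ν) (allLists-unique (size ν) (size ν))

module Branching where

  open Lists
  open Sums
  open Partitions
  open Cells
  open Tableaux
  open import Data.Bool using (T)
  open import Data.Bool.Properties using (T-∧; T-∨)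
  open import Data.Empty using (⊥-elim)
  open import Data.Nat using (ℕ; suc; _∸_; _≤_; _<_; s≤s; >-nonZero)
  open import Data.Nat.Properties using (_≟_; 1+n≢n; 1+n≰n; <-irrefl; <-≤-trans; <⇒≤pred; <⇒≱; m<n⇒m<1+n; n<1+n; suc-injective; suc-pred; ≡ᵇ⇒≡; ≡⇒≡ᵇ; ≤-antisym; ≤-pred; ≤-refl; ≤-trans; ≤-<-trans; ≤∧≢⇒<; ≮⇒≥; module ≤-Reasoning)
  open import Data.Integer using (ℤ; +_)
  open import Data.Product using (_×_; _,_; proj₁; proj₂; ∃)
  open import Data.Sum using (_⊎_; inj₁; inj₂)
  open import Data.List using (List; []; map; upTo; length; zip; concatMap)
  open import Data.List.Properties using (length-map; length-upTo)
  open import Data.List.Relation.Unary.All as All using (All)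
  open import Data.List.Relation.Unary.AllPairs using ([])
  open import Data.List.Relation.Unary.Unique.Propositional using (Unique)
  import Data.List.Relation.Unary.Unique.Propositional.Properties as Unique
  open import Data.List.Membership.Propositional using (_∈_; _∉_; find; lose)
  open import Data.List.Membership.Propositional.Properties using (∈-map⁺; ∈-map⁻; ∈-upTo⁺; ∈-concatMap⁺; ∈-concatMap⁻)
  open import Data.List.Membership.DecPropositional _≟_ using (_∈?_)
  open import Function.Base using (_∘_)
  open import Function.Bundles using (_⇔_; Equivalence)
  open import Relation.Nullary using (¬_; yes; no)
  open import Relation.Binary.PropositionalEquality using (_≡_; refl; sym; trans; cong; subst; module ≡-Reasoning)

  open Equivalence using (to; from)

  adjacent⇒ : ∀ i j i′ j′ → T (adjacentᵇ (i , j) (i′ , j′)) → (i′ ≡ i × j′ ≡ suc j) ⊎ (i′ ≡ suc i × j′ ≡ j)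
  adjacent⇒ i j i′ j′ adj with to T-∨ adj
  ... | inj₁ right = inj₁ (≡ᵇ⇒≡ i′ i (proj₁ (to T-∧ right)) , ≡ᵇ⇒≡ j′ (suc j) (proj₂ (to T-∧ right)))
  ... | inj₂ below = inj₂ (≡ᵇ⇒≡ i′ (suc i) (proj₁ (to T-∧ below)) , ≡ᵇ⇒≡ j′ j (proj₂ (to T-∧ below)))

  adjacent-right : ∀ i j → T (adjacentᵇ (i , j) (i , suc j))
  adjacent-right i j = from T-∨ (inj₁ (from T-∧ (≡⇒≡ᵇ i i refl , ≡⇒≡ᵇ j j refl)))

  adjacent-below : ∀ i j → T (adjacentᵇ (i , j) (suc i , j))
  adjacent-below i j = from T-∨ (inj₂ (from T-∧ (≡⇒≡ᵇ i i refl , ≡⇒≡ᵇ j j refl)))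

  adjacent-irreflexive : ∀ c → ¬ T (adjacentᵇ c c)
  adjacent-irreflexive (i , j) adj with adjacent⇒ i j i j adj
  ... | inj₁ (_ , j≡) = 1+n≢n (sym j≡)
  ... | inj₂ (i≡ , _) = 1+n≢n (sym i≡)

  corner-cell-maximal : ∀ ν r → Corner ν r → ∀ {c} → c ∈ cells ν → ¬ T (adjacentᵇ (lastCell ν r) c)
  corner-cell-maximal ν r corner {i , j} c∈ adj with adjacent⇒ r (part ν r ∸ 1) i j adj | ∈-cells⁻ ν c∈
  ... | inj₁ (refl , refl) | j< = <-irrefl (suc-pred _ {{>-nonZero (corner⇒part>0 ν r corner)}}) j<
  ... | inj₂ (refl , refl) | j< = <-irrefl refl (<-≤-trans j< (<⇒≤pred corner))

  filling-insertAt : ∀ ν r k (t : List ℕ) → 0 < part ν r → length t ≡ size (removeBox ν r) →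
    zip (cells ν) (insertAt (cornerIndex ν r) k t) ≡
    insertAt (cornerIndex ν r) (lastCell ν r , k) (zip (cells (removeBox ν r)) t)
  filling-insertAt ν r k t pos len =
    trans (cong (λ cs → zip cs (insertAt (cornerIndex ν r) k t)) (cellsFrom-removeBox 0 ν r pos))
          (zip-insertAt (cornerIndex ν r) (lastCell ν r) k (cells (removeBox ν r)) t
            (trans (length-cellsFrom 0 (removeBox ν r)) (sym len)))

  increasing-insertAt : ∀ p d k F → Increasing F → (∀ {c a} → (c , a) ∈ F → a < k) →
    (∀ {c a} → (c , a) ∈ F → ¬ T (adjacentᵇ d c)) → Increasing (insertAt p (d , k) F)
  increasing-insertAt p d k F inc below nothingAfter ca∈ db∈ adj
    with ∈-insertAt⁻ p _ F ca∈ | ∈-insertAt⁻ p _ F db∈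
  ... | inj₁ refl | inj₁ refl = ⊥-elim (adjacent-irreflexive d adj)
  ... | inj₁ refl | inj₂ db∈′ = ⊥-elim (nothingAfter db∈′ adj)
  ... | inj₂ ca∈′ | inj₁ refl = below ca∈′
  ... | inj₂ ca∈′ | inj₂ db∈′ = inc ca∈′ db∈′ adj

  increasing-deleteAt : ∀ p e F → Increasing (insertAt p e F) → Increasing F
  increasing-deleteAt p e F inc ca∈ db∈ = inc (∈-insertAt⁺ p e ca∈) (∈-insertAt⁺ p e db∈)

  -- For a corner r of ν with |ν| = k + 1, inserting the label k at the corner of row r
  -- turns tableaux of shape ν - r into tableaux of shape ν, and back.
  module CornerInsertion (ν : List ℕ) (k r : ℕ) (size≡ : size ν ≡ suc k) (corner : Corner ν r) where

    pos : 0 < part ν r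
    pos = corner⇒part>0 ν r corner

    p : ℕ
    p = cornerIndex ν r

    size-removed : size (removeBox ν r) ≡ k
    size-removed = suc-injective (trans (size-removeBox ν r pos) size≡)

    cells-removed⊆cells : ∀ {c} → c ∈ cells (removeBox ν r) → c ∈ cells ν
    cells-removed⊆cells c∈ = subst (_ ∈_) (sym (cellsFrom-removeBox 0 ν r pos)) (∈-insertAt⁺ p _ c∈)

    insert-SYT : ∀ t → IsSYT (removeBox ν r) t → IsSYT ν (insertAt p k t)
    insert-SYT t syt = record
      { length≡    = trans (length-insertAt p k t) (trans (cong suc (trans length≡ size-removed)) (sym size≡))
      ; bounded    = All.tabulate bounded′
      ; distinct   = Unique-insertAt⁺ p k distinct (λ k∈ → <-irrefl refl (label<k k∈))
      ; increasing = subst Increasing (sym (filling-insertAt ν r k t pos length≡))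
          (increasing-insertAt p (lastCell ν r) k (zip cells′ t) increasing (label<k ∘ zip-∈₂ cells′ t)
            (corner-cell-maximal ν r corner ∘ cells-removed⊆cells ∘ zip-∈₁ cells′ t))
      }
      where
      open IsSYT syt
      cells′ : List (ℕ × ℕ)
      cells′ = cells (removeBox ν r)
      label<k : ∀ {y} → y ∈ t → y < k
      label<k y∈ = subst (_ <_) size-removed (All.lookup bounded y∈)
      bounded′ : ∀ {y} → y ∈ insertAt p k t → y < size ν
      bounded′ y∈ with ∈-insertAt⁻ p k t y∈
      ... | inj₁ refl = subst (k <_) (sym size≡) (n<1+n k)
      ... | inj₂ y∈′  = subst (_ <_) (sym size≡) (m<n⇒m<1+n (label<k y∈′))

    length-deleteAt : ∀ x (t : List ℕ) → length (insertAt p x t) ≡ size ν → length t ≡ size (removeBox ν r)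
    length-deleteAt x t len = suc-injective (begin
      suc (length t)             ≡⟨ sym (length-insertAt p x t) ⟩
      length (insertAt p x t)    ≡⟨ len ⟩
      size ν                     ≡⟨ size≡ ⟩
      suc k                      ≡⟨ cong suc (sym size-removed) ⟩
      suc (size (removeBox ν r)) ∎)
      where open ≡-Reasoning

    label-at-corner : ∀ x y (t : List ℕ) → length (insertAt p x t) ≡ size ν →
      (lastCell ν r , y) ∈ zip (cells ν) (insertAt p x t) → x ≡ y
    label-at-corner x y t len dy∈
      with ∈-insertAt⁻ p (lastCell ν r , x) (zip (cells (removeBox ν r)) t) (subst (_ ∈_) (filling-insertAt ν r x t pos (length-deleteAt x t len)) dy∈)
    ... | inj₁ refl = refl
    ... | inj₂ dy∈′ = ⊥-elim (<-irrefl (sym (trans (part-removeBox ν r r) (cong (part ν r ∸_) (δ-self r))))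
                                       (∈-cells⁻ (removeBox ν r) (zip-∈₁ (cells (removeBox ν r)) t dy∈′)))

    corner-position< : ∀ (t : List ℕ) → length t ≡ size ν → p < length t
    corner-position< t len = begin-strict
      p                    ≤⟨ cornerIndex≤size ν r pos ⟩
      size (removeBox ν r) ≡⟨ size-removed ⟩
      k                    <⟨ n<1+n k ⟩
      suc k                ≡⟨ sym (trans len size≡) ⟩
      length t             ∎
      where open ≤-Reasoning

    split-at-corner : ∀ t → length t ≡ size ν → (lastCell ν r , k) ∈ zip (cells ν) t →
      ∃ λ t′ → t ≡ insertAt p k t′
    split-at-corner t len dk∈ with insertAt-split p t (corner-position< t len)
    ... | x , t′ , refl = t′ , cong (λ y → insertAt p y t′) (label-at-corner x k t′ len dk∈)

    remove-SYT : ∀ (t : List ℕ) → IsSYT ν (insertAt p k t) → IsSYT (removeBox ν r) t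
    remove-SYT t syt = record
      { length≡    = length-t
      ; bounded    = All.tabulate (λ y∈ → subst (_ <_) (sym size-removed) (label<k y∈))
      ; distinct   = proj₁ (Unique-insertAt⁻ p k t distinct)
      ; increasing = increasing-deleteAt p (lastCell ν r , k) (zip (cells (removeBox ν r)) t) (subst Increasing (filling-insertAt ν r k t pos length-t) increasing)
      }
      where
      open IsSYT syt
      length-t : length t ≡ size (removeBox ν r)
      length-t = length-deleteAt k t length≡
      label<k : ∀ {y} → y ∈ t → y < k
      label<k y∈ = ≤∧≢⇒< (≤-pred (subst (_ <_) size≡ (All.lookup bounded (∈-insertAt⁺ p k y∈))))
                         (λ { refl → proj₂ (Unique-insertAt⁻ p k t distinct) y∈ })

  largest-occurs : ∀ k t → length t ≡ suc k → All (_< suc k) t → Unique t → k ∈ t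
  largest-occurs k t len bounded u with k ∈? t
  ... | yes k∈ = k∈
  ... | no  k∉ = ⊥-elim (1+n≰n (begin
    suc k           ≡⟨ sym len ⟩
    length t        ≤⟨ unique-⊆⇒length≤ u (λ y∈ → ∈-upTo⁺ (below-k y∈)) ⟩
    length (upTo k) ≡⟨ length-upTo k ⟩
    k               ∎))
    where
    open ≤-Reasoning
    below-k : ∀ {y} → y ∈ t → y < k
    below-k y∈ = ≤∧≢⇒< (≤-pred (All.lookup bounded y∈)) (λ { refl → k∉ y∈ })

  cells-aligned : ∀ {ν t} → IsSYT ν t → length (cells ν) ≡ length t
  cells-aligned {ν} syt = trans (length-cellsFrom 0 ν) (sym (IsSYT.length≡ syt))

  largest-label-occurs : ∀ ν k t → IsSYT ν t → size ν ≡ suc k → k ∈ t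
  largest-label-occurs ν k t syt size≡ =
    largest-occurs k t (trans length≡ size≡) (subst (λ n → All (_< n) t) size≡ bounded) distinct
    where open IsSYT syt

  largest-at-corner : ∀ ν k t i j → IsSYT ν t → size ν ≡ suc k → ((i , j) , k) ∈ zip (cells ν) t →
    Corner ν i × j ≡ part ν i ∸ 1
  largest-at-corner ν k t i j syt size≡ ij∈ =
    subst (part ν (suc i) <_) (sym row-end) (s≤s (≮⇒≥ (vacant (adjacent-below i j) ∘ ∈-cells⁺ ν))) ,
    sym (cong (_∸ 1) row-end)
    where
    open IsSYT syt
    -- a successor cell would carry a label larger than the largest one
    vacant : ∀ {c} → T (adjacentᵇ (i , j) c) → c ∉ cells ν
    vacant adj c∈ with zip-partner₂ (cells ν) t c∈ (cells-aligned syt)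
    ... | b , cb∈ = <-irrefl refl (<-≤-trans (increasing ij∈ cb∈ adj)
                      (≤-pred (subst (b <_) size≡ (All.lookup bounded (zip-∈₂ (cells ν) t cb∈)))))
    row-end : part ν i ≡ suc j
    row-end = ≤-antisym (≮⇒≥ (vacant (adjacent-right i j) ∘ ∈-cells⁺ ν)) (∈-cells⁻ ν (zip-∈₁ (cells ν) t ij∈))

  largest-split : ∀ ν k t → IsSYT ν t → size ν ≡ suc k →
    ∃ λ r → Corner ν r × ∃ λ t′ → t ≡ insertAt (cornerIndex ν r) k t′
  largest-split ν k t syt size≡ with zip-partner₁ (cells ν) t (largest-label-occurs ν k t syt size≡) (cells-aligned syt)
  ... | (i , j) , ij∈ with largest-at-corner ν k t i j syt size≡ ij∈
  ...   | corner , refl = i , corner , split-at-corner t (IsSYT.length≡ syt) ij∈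
    where open CornerInsertion ν k i size≡ corner

  largestAt : List ℕ → ℕ → ℕ → List (List ℕ)
  largestAt ν k r with corner? ν r
  ... | yes _ = map (insertAt (cornerIndex ν r) k) (SYTs (removeBox ν r))
  ... | no  _ = []

  ∈-largestAt⁻ : ∀ ν k r {t} → size ν ≡ suc k → t ∈ largestAt ν k r → IsSYT ν t
  ∈-largestAt⁻ ν k r size≡ t∈ with corner? ν r
  ... | yes corner with ∈-map⁻ _ t∈
  ...   | t′ , t′∈ , refl = insert-SYT t′ (to (∈-SYTs⇔IsSYT (removeBox ν r) t′) t′∈)
    where open CornerInsertion ν k r size≡ corner

  ∈-largestAt⁺ : ∀ ν k r t′ → size ν ≡ suc k → Corner ν r → IsSYT ν (insertAt (cornerIndex ν r) k t′) →
    insertAt (cornerIndex ν r) k t′ ∈ largestAt ν k r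
  ∈-largestAt⁺ ν k r t′ size≡ corner syt with corner? ν r
  ... | yes _      = ∈-map⁺ _ (from (∈-SYTs⇔IsSYT (removeBox ν r) t′) (remove-SYT t′ syt))
    where open CornerInsertion ν k r size≡ corner
  ... | no ¬corner = ⊥-elim (¬corner corner)

  largestAt-unique : ∀ ν k r → Unique (largestAt ν k r)
  largestAt-unique ν k r with corner? ν r
  ... | yes _ = Unique.map⁺ (insertAt-injective _ k _ _) (SYTs-unique (removeBox ν r))
  ... | no  _ = []

  length-largestAt : ∀ ν k r → + length (largestAt ν k r) ≡ when (corner? ν r) (+ f (removeBox ν r))
  length-largestAt ν k r with corner? ν r
  ... | yes _ = cong +_ (length-map _ (SYTs (removeBox ν r)))
  ... | no  _ = refl

  -- The families are disjoint: the row r is that of the cell carrying the label k.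
  largestAt-disjoint : ∀ ν k {r r′ t} → size ν ≡ suc k → t ∈ largestAt ν k r → t ∈ largestAt ν k r′ → r ≡ r′
  largestAt-disjoint ν k {r} {r′} {t} size≡ t∈ t∈′ = cong proj₁ (zip-partner-unique (cells ν) t (IsSYT.distinct syt) (at-corner t∈) (at-corner t∈′))
    where
    syt : IsSYT ν t
    syt = ∈-largestAt⁻ ν k r size≡ t∈
    at-corner : ∀ {s t} → t ∈ largestAt ν k s → (lastCell ν s , k) ∈ zip (cells ν) t
    at-corner {s} t∈ with corner? ν s
    ... | yes corner with ∈-map⁻ _ t∈
    ...   | t′ , t′∈ , refl = subst (_ ∈_) (sym (filling-insertAt ν s k t′ pos length-t′)) (∈-insertAt-self _ _ _)
      where
      open CornerInsertion ν k s size≡ corner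
      length-t′ : length t′ ≡ size (removeBox ν s)
      length-t′ = IsSYT.length≡ (to (∈-SYTs⇔IsSYT (removeBox ν s) t′) t′∈)

  SYTs-by-largest : ∀ ν k → size ν ≡ suc k → length (SYTs ν) ≡ length (concatMap (largestAt ν k) (upTo (length ν)))
  SYTs-by-largest ν k size≡ = unique-same-members⇒same-length (SYTs-unique ν)
    (concatMap-unique (largestAt ν k) (Unique.upTo⁺ (length ν)) (largestAt-unique ν k) (largestAt-disjoint ν k size≡))
    decompose compose
    where
    decompose : ∀ {t} → t ∈ SYTs ν → t ∈ concatMap (largestAt ν k) (upTo (length ν))
    decompose {t} t∈ with largest-split ν k t (to (∈-SYTs⇔IsSYT ν t) t∈) size≡
    ... | r , corner , t′ , refl = ∈-concatMap⁺ (largestAt ν k)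
            (lose (∈-upTo⁺ (corner⇒<length ν r corner)) (∈-largestAt⁺ ν k r t′ size≡ corner (to (∈-SYTs⇔IsSYT ν t) t∈)))
    compose : ∀ {t} → t ∈ concatMap (largestAt ν k) (upTo (length ν)) → t ∈ SYTs ν
    compose t∈ with find (∈-concatMap⁻ (largestAt ν k) {xs = upTo (length ν)} t∈)
    ... | r , _ , t∈r = from (∈-SYTs⇔IsSYT ν _) (∈-largestAt⁻ ν k r size≡ t∈r)

  ∑-corners : ∀ ν m n (h : ℕ → ℤ) → length ν ≤ m → m ≤ n →
    ∑ n (λ r → when (corner? ν r) (h r)) ≡ ∑ m (λ r → when (corner? ν r) (h r))
  ∑-corners ν m n h ℓ≤m m≤n = ∑-extend m n _ m≤n (λ r m≤r → when-no (corner? ν r) (λ c → <⇒≱ (corner⇒<length ν r c) (≤-trans ℓ≤m m≤r)))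

  branching : ∀ ν k M → size ν ≡ suc k → length ν ≤ M →
    + f ν ≡ ∑ M (λ r → when (corner? ν r) (+ f (removeBox ν r)))
  branching ν k M size≡ ℓ≤M = begin
    + length (SYTs ν)                                              ≡⟨ cong +_ (SYTs-by-largest ν k size≡) ⟩
    + length (concatMap (largestAt ν k) (upTo (length ν)))         ≡⟨ length-concatMap-upTo (length ν) (largestAt ν k) ⟩
    ∑ (length ν) (λ r → + length (largestAt ν k r))                ≡⟨ ∑-cong (length ν) (λ r _ → length-largestAt ν k r) ⟩
    ∑ (length ν) (λ r → when (corner? ν r) (+ f (removeBox ν r)))  ≡⟨ sym (∑-corners ν (length ν) M _ ≤-refl ℓ≤M) ⟩
    ∑ M (λ r → when (corner? ν r) (+ f (removeBox ν r)))           ∎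
    where open ≡-Reasoning

module UpDown where

  open Sums
  open Partitions
  open Branching
  open import Data.Nat using (ℕ; zero; suc; _∸_; _≤_; _<_)
  open import Data.Nat.Properties using (_≟_; 1+n≢0; <⇒≤; suc-injective; ≤-<-trans; ≤-trans)
  open import Data.Integer using (ℤ; +_; _+_; _*_; _-_)
  import Data.Integer.Properties as ℤ
  open import Data.Integer.Tactic.RingSolver using (solve-∀)
  open import Data.Product using (_×_; _,_)
  open import Data.List using (List; length)
  open import Function.Base using (_∘_)
  open import Function.Bundles using (_⇔_; mk⇔; Equivalence)
  open import Relation.Nullary using (¬_; yes; no)
  open import Relation.Nullary.Decidable using (¬?; _×-dec_)
  open import Relation.Binary.PropositionalEquality using (_≡_; refl; sym; trans; cong; cong₂; module ≡-Reasoning)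

  open Equivalence using (to; from)

  F : List ℕ → ℤ
  F ν = + f ν

  upSum : (ℕ → ℕ → ℤ) → List ℕ → ℕ → ℤ
  upSum w ν M = ∑ M (λ a → when (addable? ν a) (w a (part ν a) * F (addBox ν a)))

  addWeight : (ℕ → ℕ → ℤ) → List ℕ → ℕ → ℤ
  addWeight w ν M = ∑ M (λ a → when (addable? ν a) (w a (part ν a)))

  -- (the box of corner r has, after its removal, row length part (ν - r) r)
  removeWeight : (ℕ → ℕ → ℤ) → List ℕ → ℕ → ℤ
  removeWeight w ν M = ∑ M (λ r → when (corner? ν r) (w r (part (removeBox ν r) r)))

  -- Up-down recursion: expanding f (ν + a) by the branching rule and commuting
  -- "add at a" with "remove at r" for a ≠ r expresses upSum w ν through the upSum w (ν - r).
  module UpDownRecursion (w : ℕ → ℕ → ℤ) (ν : List ℕ) (P : IsPartition ν) (M : ℕ) (ℓ<M : length ν < M) where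

    up-down : ℕ → ℕ → ℤ
    up-down a r = when (addable? ν a) (when (¬? (r ≟ a)) (when (corner? (addBox ν a) r)
                    (w a (part ν a) * F (removeBox (addBox ν a) r))))

    down-up : ℕ → ℕ → ℤ
    down-up r a = when (corner? ν r) (when (¬? (a ≟ r)) (when (addable? (removeBox ν r) a)
                    (w a (part (removeBox ν r) a) * F (addBox (removeBox ν r) a))))

    -- Expanding f (ν + a) by the branching rule: removing the box just added gives back ν,
    -- removing another box gives the terms up-down a r.
    up-then-down : ∀ a → a < M →
      when (addable? ν a) (w a (part ν a) * F (addBox ν a)) ≡ when (addable? ν a) (w a (part ν a)) * F ν + ∑ M (up-down a)
    up-then-down a a<M with addable? ν a
    ... | no ¬add = sym (trans (cong (λ s → + 0 * F ν + s) (∑-zero M (λ r _ → refl)))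
                               (ℤ.+-identityʳ (+ 0 * F ν)))
    ... | yes add = begin
      c * F μ                                                            ≡⟨ cong (λ s → c * s) (branching μ (size ν) M (size-addBox ν a a≤) ℓμ≤M) ⟩
      c * ∑ M down                                                       ≡⟨ cong (λ s → c * s) (∑-pick M a down a<M) ⟩
      c * (down a + ∑ M (λ r → when (¬? (r ≟ a)) (down r)))              ≡⟨ cong (λ d → c * (d + ∑ M (λ r → when (¬? (r ≟ a)) (down r)))) picked ⟩
      c * (F ν + ∑ M (λ r → when (¬? (r ≟ a)) (down r)))                 ≡⟨ ℤ.*-distribˡ-+ c (F ν) _ ⟩
      c * F ν + c * ∑ M (λ r → when (¬? (r ≟ a)) (down r))               ≡⟨ cong (λ s → c * F ν + s) (sym (∑-*ˡ M c _)) ⟩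
      c * F ν + ∑ M (λ r → c * when (¬? (r ≟ a)) (down r))               ≡⟨ cong (λ s → c * F ν + s) (∑-cong M scaled) ⟩
      c * F ν + ∑ M (λ r → when (¬? (r ≟ a)) (when (corner? μ r) (c * F (removeBox μ r)))) ∎
      where
      open ≡-Reasoning
      μ : List ℕ
      μ = addBox ν a
      c : ℤ
      c = w a (part ν a)
      a≤ : a ≤ length ν
      a≤ = addable⇒≤length ν a add
      ℓμ≤M : length μ ≤ M
      ℓμ≤M = ≤-trans (length-addBox ν a) ℓ<M
      down : ℕ → ℤ
      down r = when (corner? μ r) (F (removeBox μ r))
      picked : down a ≡ F ν
      picked = trans (when-yes (corner? μ a) (corner-addBox ν a P add)) (cong F (removeBox-addBox ν a P add))
      scaled : ∀ r → r < M → c * when (¬? (r ≟ a)) (down r) ≡ when (¬? (r ≟ a)) (when (corner? μ r) (c * F (removeBox μ r)))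
      scaled r _ = sym (trans (cong (when (¬? (r ≟ a))) (when-*ˡ (corner? μ r) c _)) (when-*ˡ (¬? (r ≟ a)) c _))

    -- Dually, in upSum w (ν - r) the term a = r gives back ν and the others are the down-up r a.
    down-then-up : ∀ r → r < M →
      when (corner? ν r) (w r (part (removeBox ν r) r)) * F ν + ∑ M (down-up r) ≡ when (corner? ν r) (upSum w (removeBox ν r) M)
    down-then-up r r<M with corner? ν r
    ... | no _ = trans (cong₂ _+_ (ℤ.*-zeroˡ (F ν)) (∑-zero M (λ _ _ → refl))) (ℤ.+-identityʳ (+ 0))
    ... | yes corner = sym (begin
      ∑ M up                                               ≡⟨ ∑-pick M r up r<M ⟩
      up r + ∑ M (λ a → when (¬? (a ≟ r)) (up a))          ≡⟨ cong (λ u → u + ∑ M (λ a → when (¬? (a ≟ r)) (up a))) picked ⟩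
      c * F ν + ∑ M (λ a → when (¬? (a ≟ r)) (up a))       ∎)
      where
      open ≡-Reasoning
      κ : List ℕ
      κ = removeBox ν r
      c : ℤ
      c = w r (part κ r)
      up : ℕ → ℤ
      up a = when (addable? κ a) (w a (part κ a) * F (addBox κ a))
      picked : up r ≡ c * F ν
      picked = trans (when-yes (addable? κ r) (addable-removeBox ν r P corner)) (cong (λ μ → c * F μ) (addBox-removeBox ν r P corner))

    up-down≡down-up : ∀ a r → up-down a r ≡ down-up r a
    up-down≡down-up a r = begin
      up-down a r
        ≡⟨ flatten (addable? ν a) (¬? (r ≟ a)) (corner? (addBox ν a) r) _ ⟩
      when (addable? ν a ×-dec (¬? (r ≟ a) ×-dec corner? (addBox ν a) r)) (w a (part ν a) * F (removeBox (addBox ν a) r))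
        ≡⟨ when-cong _ _ (mk⇔ swap-to swap-from) same-value ⟩
      when (corner? ν r ×-dec (¬? (a ≟ r) ×-dec addable? (removeBox ν r) a)) (w a (part (removeBox ν r) a) * F (addBox (removeBox ν r) a))
        ≡⟨ sym (flatten (corner? ν r) (¬? (a ≟ r)) (addable? (removeBox ν r) a) _) ⟩
      down-up r a ∎
      where
      open ≡-Reasoning
      flatten : ∀ {A B C : Set} A? B? C? x → when {A} A? (when {B} B? (when {C} C? x)) ≡ when (A? ×-dec (B? ×-dec C?)) x
      flatten A? B? C? x = trans (cong (when A?) (when-when B? C? x)) (when-when A? (B? ×-dec C?) x)
      swap-to : Addable ν a × (¬ r ≡ a × Corner (addBox ν a) r) → Corner ν r × (¬ a ≡ r × Addable (removeBox ν r) a)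
      swap-to (add , r≢a , c′) with to (addable-corner-swap ν a r (r≢a ∘ sym) (addable⇒≤length ν a add)) (add , c′)
      ... | c , add′ = c , r≢a ∘ sym , add′
      row-of-ν : Addable (removeBox ν r) a → a ≤ length ν
      row-of-ν add′ = ≤-trans (addable⇒≤length (removeBox ν r) a add′) (length-removeBox ν r)
      swap-from : Corner ν r × (¬ a ≡ r × Addable (removeBox ν r) a) → Addable ν a × (¬ r ≡ a × Corner (addBox ν a) r)
      swap-from (c , a≢r , add′) with from (addable-corner-swap ν a r a≢r (row-of-ν add′)) (c , add′)
      ... | add , c′ = add , a≢r ∘ sym , c′
      same-value : Addable ν a × (¬ r ≡ a × Corner (addBox ν a) r) → Corner ν r × (¬ a ≡ r × Addable (removeBox ν r) a) →
        w a (part ν a) * F (removeBox (addBox ν a) r) ≡ w a (part (removeBox ν r) a) * F (addBox (removeBox ν r) a)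
      same-value (add , _ , c′) (_ , a≢r , _) =
        cong₂ _*_ (cong (w a) (sym (trans (part-removeBox ν r a) (cong (part ν a ∸_) (δ-≢ a r a≢r)))))
                  (cong F (removeBox-addBox-comm ν a r P a≢r add c′))

    up-down-recursion :
      upSum w ν M + removeWeight w ν M * F ν ≡
      addWeight w ν M * F ν + ∑ M (λ r → when (corner? ν r) (upSum w (removeBox ν r) M))
    up-down-recursion = begin
      upSum w ν M + C * F ν           ≡⟨ cong (λ u → u + C * F ν) expand-up ⟩
      (A * F ν + D) + C * F ν         ≡⟨ regroup (A * F ν) (C * F ν) D ⟩
      A * F ν + (C * F ν + D)         ≡⟨ cong (λ u → A * F ν + u) (sym expand-down) ⟩
      A * F ν + ∑ M (λ r → when (corner? ν r) (upSum w (removeBox ν r) M)) ∎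
      where
      open ≡-Reasoning
      A C D : ℤ
      A = addWeight w ν M
      C = removeWeight w ν M
      D = ∑ M (λ r → ∑ M (down-up r))
      regroup : ∀ x y z → (x + z) + y ≡ x + (y + z)
      regroup = solve-∀
      expand-up : upSum w ν M ≡ A * F ν + D
      expand-up = begin
        upSum w ν M
          ≡⟨ ∑-cong M up-then-down ⟩
        ∑ M (λ a → when (addable? ν a) (w a (part ν a)) * F ν + ∑ M (up-down a))
          ≡⟨ ∑-+ M _ _ ⟩
        ∑ M (λ a → when (addable? ν a) (w a (part ν a)) * F ν) + ∑ M (λ a → ∑ M (up-down a))
          ≡⟨ cong₂ _+_ (∑-*ʳ M (F ν) _) (∑-swap M M up-down) ⟩
        A * F ν + ∑ M (λ r → ∑ M (λ a → up-down a r))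
          ≡⟨ cong (λ u → A * F ν + u) (∑-cong M (λ r _ → ∑-cong M (λ a _ → up-down≡down-up a r))) ⟩
        A * F ν + D ∎
      expand-down : ∑ M (λ r → when (corner? ν r) (upSum w (removeBox ν r) M)) ≡ C * F ν + D
      expand-down = begin
        ∑ M (λ r → when (corner? ν r) (upSum w (removeBox ν r) M))
          ≡⟨ ∑-cong M (λ r r<M → sym (down-then-up r r<M)) ⟩
        ∑ M (λ r → when (corner? ν r) (w r (part (removeBox ν r) r)) * F ν + ∑ M (down-up r))
          ≡⟨ ∑-+ M _ _ ⟩
        ∑ M (λ r → when (corner? ν r) (w r (part (removeBox ν r) r)) * F ν) + D
          ≡⟨ cong (_+ D) (∑-*ʳ M (F ν) _) ⟩
        C * F ν + D ∎

  no-corner-of-empty : ∀ ν r → size ν ≡ 0 → ¬ Corner ν r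
  no-corner-of-empty ν r size≡0 c = 1+n≢0 (trans (size-removeBox ν r (corner⇒part>0 ν r c)) size≡0)

  upSum-constant-excess : ∀ w e → (∀ μ M → IsPartition μ → length μ < M → addWeight w μ M ≡ e + removeWeight w μ M) →
    ∀ n ν M → IsPartition ν → size ν ≡ n → length ν < M → upSum w ν M ≡ e * (+ suc n * F ν)
  upSum-constant-excess w e excess n ν M P size≡ ℓ<M = begin
    upSum w ν M                                 ≡⟨ isolate (upSum w ν M) (R * F ν) ⟩
    (upSum w ν M + R * F ν) - R * F ν           ≡⟨ cong (_- R * F ν) (UpDownRecursion.up-down-recursion w ν P M ℓ<M) ⟩
    (A * F ν + L) - R * F ν                     ≡⟨ cong₂ (λ a l → (a * F ν + l) - R * F ν) (excess ν M P ℓ<M) (removals n size≡) ⟩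
    ((e + R) * F ν + e * (+ n * F ν)) - R * F ν ≡⟨ collect e R (+ n) (F ν) ⟩
    e * ((+ 1 + + n) * F ν)                     ≡⟨ cong (λ m → e * (m * F ν)) (sym (ℤ.pos-+ 1 n)) ⟩
    e * (+ suc n * F ν)                         ∎
    where
    open ≡-Reasoning
    A R L : ℤ
    A = addWeight w ν M
    R = removeWeight w ν M
    L = ∑ M (λ r → when (corner? ν r) (upSum w (removeBox ν r) M))
    isolate : ∀ u x → u ≡ (u + x) - x
    isolate = solve-∀
    collect : ∀ e r m g → ((e + r) * g + e * (m * g)) - r * g ≡ e * ((+ 1 + m) * g)
    collect = solve-∀
    -- by induction, each corner row r contributes e |ν| f (ν - r); the branching rule sums these
    removals : ∀ n → size ν ≡ n → L ≡ e * (+ n * F ν)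
    removals zero    size≡0 = trans (∑-zero M (λ r _ → when-no (corner? ν r) (no-corner-of-empty ν r size≡0)))
                                    (sym (trans (cong (e *_) (ℤ.*-zeroˡ (F ν))) (ℤ.*-zeroʳ e)))
    removals (suc k) size≡  = begin
      L                                                               ≡⟨ ∑-cong M by-induction ⟩
      ∑ M (λ r → (e * + suc k) * when (corner? ν r) (F (removeBox ν r))) ≡⟨ ∑-*ˡ M (e * + suc k) _ ⟩
      (e * + suc k) * ∑ M (λ r → when (corner? ν r) (F (removeBox ν r))) ≡⟨ cong ((e * + suc k) *_) (sym (branching ν k M size≡ (<⇒≤ ℓ<M))) ⟩
      (e * + suc k) * F ν                                             ≡⟨ ℤ.*-assoc e (+ suc k) (F ν) ⟩
      e * (+ suc k * F ν)                                             ∎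
      where
      by-induction : ∀ r → r < M → when (corner? ν r) (upSum w (removeBox ν r) M) ≡ (e * + suc k) * when (corner? ν r) (F (removeBox ν r))
      by-induction r _ with corner? ν r
      ... | no  _      = sym (ℤ.*-zeroʳ (e * + suc k))
      ... | yes corner = trans (upSum-constant-excess w e excess k (removeBox ν r) M (removeBox-partition ν r P corner)
                                  (suc-injective (trans (size-removeBox ν r (corner⇒part>0 ν r corner)) size≡))
                                  (≤-<-trans (length-removeBox ν r) ℓ<M))
                               (sym (ℤ.*-assoc e (+ suc k) (F (removeBox ν r))))

open Sums
open Partitions
open Branching
open UpDown
open import Data.Nat using (ℕ; zero; suc; _∸_; _<_; _≥_; s≤s)
open import Data.Nat.Properties using (≤-refl; m≤n⇒m≤1+n; ≤-antisym; ≮⇒≥)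
open import Data.Integer using (ℤ; +_; _+_; _*_; _-_; -_)
import Data.Integer.Properties as ℤ
open import Data.Integer.Tactic.RingSolver using (solve-∀)
open import Data.List using (List; length; map; filter; foldr; applyUpTo)
open import Function.Base using (_∘_)
open import Function.Bundles using (_⇔_; mk⇔)
open import Relation.Nullary using (Dec; yes; no)
open import Relation.Unary using (Decidable)
open import Relation.Binary.PropositionalEquality using (_≡_; refl; sym; trans; cong; cong₂; module ≡-Reasoning)

one : ℕ → ℕ → ℤ
one _ _ = + 1

-- Content weight: the box added at the end of row a (of length ℓ) has content ℓ - a.
content : ℕ → ℕ → ℤ
content a ℓ = + ℓ - + a

one-excess : ∀ μ M → IsPartition μ → length μ < M → addWeight one μ M ≡ + 1 + removeWeight one μ M
one-excess μ (suc M) _ (s≤s ℓ≤M) =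
  cong (λ s → + 1 + s) (trans (∑-corners μ (length μ) M (λ _ → + 1) ≤-refl ℓ≤M)
                          (sym (∑-corners μ (length μ) (suc M) (λ _ → + 1) ≤-refl (m≤n⇒m≤1+n ℓ≤M))))

content-excess : ∀ μ M → IsPartition μ → length μ < M → addWeight content μ M ≡ + 0 + removeWeight content μ M
content-excess μ (suc M) P (s≤s ℓ≤M) = begin
  (+ part μ 0 - + 0) + ∑ M (λ j → when (corner? μ j) (content (suc j) (part μ (suc j))))
    ≡⟨ cong (λ s → (+ part μ 0 - + 0) + s) (∑-corners μ ℓ M _ ≤-refl ℓ≤M) ⟩
  (+ part μ 0 - + 0) + ∑ ℓ (λ j → when (corner? μ j) (content (suc j) (part μ (suc j))))
    ≡⟨ cong (λ s → (+ part μ 0 - + 0) + s) (trans (∑-cong ℓ shift) (∑-+ ℓ removed step)) ⟩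
  (+ part μ 0 - + 0) + (∑ ℓ removed + ∑ ℓ step)
    ≡⟨ cong (λ s → (+ part μ 0 - + 0) + (∑ ℓ removed + s)) (trans (∑-telescope ℓ (part μ)) (cong (λ p → + p - + part μ 0) (part-length μ))) ⟩
  (+ part μ 0 - + 0) + (∑ ℓ removed + (+ 0 - + part μ 0))
    ≡⟨ cancel (+ part μ 0) (∑ ℓ removed) ⟩
  + 0 + ∑ ℓ removed
    ≡⟨ cong (λ s → + 0 + s) (sym (∑-corners μ ℓ (suc M) _ ≤-refl (m≤n⇒m≤1+n ℓ≤M))) ⟩
  + 0 + removeWeight content μ (suc M) ∎
  where
  open ≡-Reasoning
  ℓ : ℕ
  ℓ = length μ
  removed : ℕ → ℤ
  removed r = when (corner? μ r) (content r (part (removeBox μ r) r))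
  step : ℕ → ℤ
  step j = + part μ (suc j) - + part μ j
  cancel : ∀ p s → (p - + 0) + (s + (+ 0 - p)) ≡ + 0 + s
  cancel = solve-∀
  -- the cell below a corner of row j has the content of that corner shifted by the row-length drop
  shift : ∀ j → j < ℓ → when (corner? μ j) (content (suc j) (part μ (suc j))) ≡ removed j + step j
  shift j _ with corner? μ j
  ... | yes c = trans (below (part μ j) (corner⇒part>0 μ j c))
                      (cong (λ p → (+ p - + j) + step j) (sym (trans (part-removeBox μ j j) (cong (part μ j ∸_) (δ-self j)))))
    where
    below : ∀ p → 0 < p → + part μ (suc j) - + suc j ≡ (+ (p ∸ 1) - + j) + (+ part μ (suc j) - + p)
    below (suc p) _ rewrite ℤ.pos-+ 1 j | ℤ.pos-+ 1 p = regroup (+ part μ (suc j)) (+ p) (+ j)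
      where
      regroup : ∀ q p j → q - (+ 1 + j) ≡ (p - j) + (q - (+ 1 + p))
      regroup = solve-∀
  ... | no ¬c rewrite ≤-antisym (partition-monotone P j) (≮⇒≥ ¬c) = sym (trans (ℤ.+-identityˡ _) (ℤ.+-inverseʳ (+ part μ j)))

sum-filter : ∀ {P : ℕ → Set} (P? : Decidable P) (g : ℕ → ℤ) n (φ : ℕ → ℕ) →
  foldr _+_ (+ 0) (map g (filter P? (applyUpTo φ n))) ≡ ∑ n (λ i → when (P? (φ i)) (g (φ i)))
sum-filter P? g zero    φ = refl
sum-filter P? g (suc n) φ with P? (φ 0)
... | yes _ = cong (λ s → g (φ 0) + s) (sum-filter P? g n (φ ∘ suc))
... | no  _ = trans (sum-filter P? g n (φ ∘ suc)) (sym (ℤ.+-identityˡ _))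

rhsSum-upSums : ∀ ν → IsPartition ν →
  rhsSum ν ≡ upSum one ν (suc (length ν)) + (- + 2) * upSum content ν (suc (length ν))
rhsSum-upSums ν P = begin
  rhsSum ν
    ≡⟨ sum-filter (λ i → isPartition? (addBox ν i)) term N (λ i → i) ⟩
  ∑ N (λ a → when (isPartition? (addBox ν a)) (term a))
    ≡⟨ ∑-cong N (λ a a<N → when-cong (isPartition? (addBox ν a)) (addable? ν a) (valid⇔addable a a<N) (λ _ _ → refl {x = term a})) ⟩
  ∑ N (λ a → when (addable? ν a) (term a))
    ≡⟨ ∑-cong N (λ a _ → split (addable? ν a) (F (addBox ν a)) (content a (part ν a))) ⟩
  ∑ N (λ a → counted a + (- + 2) * weighted a)
    ≡⟨ trans (∑-+ N counted (λ a → (- + 2) * weighted a)) (cong (λ s → upSum one ν N + s) (∑-*ˡ N (- + 2) weighted)) ⟩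
  upSum one ν N + (- + 2) * upSum content ν N ∎
  where
  open ≡-Reasoning
  N : ℕ
  N = suc (length ν)
  term : ℕ → ℤ
  term i = + f (addBox ν i) * (+ 1 - + 2 * contentAdded ν i)
  counted weighted : ℕ → ℤ
  counted  a = when (addable? ν a) (one a (part ν a) * F (addBox ν a))
  weighted a = when (addable? ν a) (content a (part ν a) * F (addBox ν a))
  valid⇔addable : ∀ a → a < N → IsPartition (addBox ν a) ⇔ Addable ν a
  valid⇔addable a (s≤s a≤) = mk⇔ (addBox-partition⁻ ν a a≤) (addBox-partition ν a P)
  split : ∀ {A : Set} (A? : Dec A) g c → when A? (g * (+ 1 - + 2 * c)) ≡ when A? (+ 1 * g) + (- + 2) * when A? (c * g)
  split (yes _) g c = expand g c
    where
    expand : ∀ g c → g * (+ 1 - + 2 * c) ≡ + 1 * g + (- + 2) * (c * g)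
    expand = solve-∀
  split (no _) g c = refl

mainTheorem11 : (n : ℕ) → n ≥ 1 → (ν : List ℕ) → IsPartition ν → suc (size ν) ≡ n →
    (+ n) * (+ f ν) ≡ rhsSum ν
mainTheorem11 n _ ν P refl = sym (begin
  rhsSum ν                                                         ≡⟨ rhsSum-upSums ν P ⟩
  upSum one ν N + (- + 2) * upSum content ν N                      ≡⟨ cong₂ (λ x y → x + (- + 2) * y) (by-excess one (+ 1) one-excess) (by-excess content (+ 0) content-excess) ⟩
  + 1 * (+ n * F ν) + (- + 2) * (+ 0 * (+ n * F ν))                ≡⟨ simplify (+ n * F ν) ⟩
  + n * F ν                                                        ∎)
  where
  open ≡-Reasoning
  N : ℕ
  N = suc (length ν)
  by-excess : ∀ w e → (∀ μ M → IsPartition μ → length μ < M → addWeight w μ M ≡ e + removeWeight w μ M) →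
    upSum w ν N ≡ e * (+ n * F ν)
  by-excess w e excess = upSum-constant-excess w e excess (size ν) ν N P refl ≤-refl
  simplify : ∀ x → + 1 * x + (- + 2) * (+ 0 * x) ≡ x
  simplify = solve-∀
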